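{- Let $h$ be the morphism on $\{0,1,2\}^*$ defined by $h(0)=01$, $h(1)=21$, $h(2)=0$, and let $\mathbf{p}$ be the infinite fixed point of $h$ beginning with $0$. Then $\mathbf{p}$ is $2$-balanced: for all factors $y,z$ of $\mathbf{p}$ with $|y|=|z|$ and every letter $a\in\{0,1,2\}$, we have $\left||y|_a-|z|_a\right|\leq 2$.
   Context: $|y|_a$ denotes the number of occurrences of the letter $a$ in the word $y$. -}

module Defs where

open import Data.Nat using (ℕ; zero; suc; _+_; _≤_)
open import Data.Fin using (Fin; zero; suc)
open import Data.List using (List; []; _∷_; _++_; concatMap; length)
open import Data.Bool using (if_then_else_)
open import Relation.Nullary.Decidable using (⌊_⌋)
open import Data.Fin using (_≟_)
open import Data.Product using (_×_)

Letter : Set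
Letter = Fin 3

h : Letter → List Letter
h zero = zero ∷ suc zero ∷ []
h (suc zero) = suc (suc zero) ∷ suc zero ∷ []
h (suc (suc zero)) = zero ∷ []

hWord : List Letter → List Letter
hWord = concatMap h

hIter : ℕ → List Letter
hIter zero = zero ∷ []
hIter (suc n) = hWord (hIter n)

-- i-th letter of a word, with a default (never used below, see p)
at : List Letter → ℕ → Letter
at [] _ = zero
at (x ∷ _) zero = x
at (_ ∷ xs) (suc i) = at xs i

-- The infinite fixed point p = lim h^n(0) of h beginning with 0, as a
-- function ℕ → Letter.  Since h(0) begins with 0, h^n(0) is a prefix of
-- h^(n+1)(0), and |h^(i+1)(0)| ≥ i+1, so the i-th letter of p is the
-- i-th letter of h^(i+1)(0) (the default of 'at' is never reached).
p : ℕ → Letter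
p i = at (hIter (suc i)) i

factor : ℕ → ℕ → List Letter
factor i zero = []
factor i (suc m) = p i ∷ factor (suc i) m

count : Letter → List Letter → ℕ
count a [] = 0
count a (x ∷ xs) = (if ⌊ a ≟ x ⌋ then 1 else 0) + count a xs

diffLe : ℕ → ℕ → ℕ → Set
diffLe k x y = (x ≤ y + k) × (y ≤ x + k)

-- Since p = h(p), p is the concatenation of the blocks h(p 0) h(p 1) h(p 2) …, so a window of p
-- is, up to partial blocks at its two ends, the image h(u) of an earlier window u.  Two windows of
-- the same length are thus images of windows u, v of a common length n, trimmed by at most one
-- letter at each end, where one of them may need δ further letters of p; equality of the lengths
-- forces δ ≤ 4.  As |h(u)|ₐ = Σ_b |h(b)|ₐ |u|_b, the count differences of the new pair are
-- determined by those of (u, v) and by the few letters cut off or added, which are all read off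
-- the first letters of u and v and the five letters following them.  These data form a finite
-- automaton.  A list of 3917 of its states is checked by evaluation to contain the states of all
-- pairs of empty windows and to be closed under this desubstitution step and under exchanging the
-- windows; in all of them the count differences lie in −2‥2.  Induction on (i + m) + (j + m)
-- puts the state of every pair of windows in the list.

module Submission where

open import Defs
open import Data.Bool using (Bool; true; false; T; not; _∧_; _∨_; if_then_else_)
open import Data.Bool.ListAction using (all)
open import Data.Bool.Properties using (T-∧; T-≡)
open import Data.Fin using (toℕ)
import Data.Fin as Fin
open import Data.List using (List; []; _∷_; _++_; length; take; drop; upTo; allFin)
open import Data.List.Properties
  using (length-++; ++-identityʳ; ++-assoc; concatMap-++; take++drop≡id; ∷-injective; ≡-dec)
open import Data.List.Membership.Propositional using (_∈_)
open import Data.List.Membership.Propositional.Properties using (∈-upTo⁺; ∈-allFin; ∈-++⁺ˡ; ∈-++⁺ʳ)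
open import Data.List.Membership.DecPropositional (≡-dec (Fin._≟_ {3})) using (_∈?_)
open import Data.List.Relation.Unary.Any using (here; there)
import Data.List.Relation.Unary.All as All
open import Data.List.Relation.Unary.All.Properties using (all⁺)
open import Data.Nat using (ℕ; zero; suc; _+_; _*_; _∸_; _≤_; _<_; z≤n; s≤s; _≤?_; _<?_; _≡ᵇ_; _<ᵇ_; _≤ᵇ_; _/_; _%_)
import Data.Nat as ℕ
open import Data.Nat.Properties
open import Data.Nat.Induction using (<-rec)
open import Data.Nat.Tactic.RingSolver using (solve-∀)
open import Data.Product using (∃-syntax; _×_; _,_; proj₁; proj₂)
open import Data.Tree.Binary using (Tree; leaf; node)
open import Data.Unit using (⊤; tt)
open import Function using (_∘_; Equivalence)
open import Relation.Binary.Definitions using (DecidableEquality)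
open import Relation.Binary.PropositionalEquality
open import Relation.Nullary using (yes; no)
open import Relation.Nullary.Decidable using (⌊_⌋; toWitness; map′; _×-dec_)

pattern 𝟎 = Fin.zero
pattern 𝟏 = Fin.suc Fin.zero
pattern 𝟐 = Fin.suc (Fin.suc Fin.zero)

∑ : (Letter → ℕ) → ℕ
∑ f = f 𝟎 + f 𝟏 + f 𝟐

∑-cong : ∀ {f g : Letter → ℕ} → (∀ b → f b ≡ g b) → ∑ f ≡ ∑ g
∑-cong f≡g = cong₂ _+_ (cong₂ _+_ (f≡g 𝟎) (f≡g 𝟏)) (f≡g 𝟐)

∑-+ : ∀ (f g : Letter → ℕ) → ∑ (λ b → f b + g b) ≡ ∑ f + ∑ g
∑-+ f g = regroup (f 𝟎) (f 𝟏) (f 𝟐) (g 𝟎) (g 𝟏) (g 𝟐)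
  where
  regroup : ∀ a b c x y z → a + x + (b + y) + (c + z) ≡ a + b + c + (x + y + z)
  regroup = solve-∀

*-∑ : ∀ k (f : Letter → ℕ) → k * ∑ f ≡ ∑ (λ b → k * f b)
*-∑ k f = trans (*-distribˡ-+ k (f 𝟎 + f 𝟏) (f 𝟐)) (cong (_+ k * f 𝟐) (*-distribˡ-+ k (f 𝟎) (f 𝟏)))

1≤length-h : ∀ x → 1 ≤ length (h x)
1≤length-h 𝟎 = s≤s z≤n
1≤length-h 𝟏 = s≤s z≤n
1≤length-h 𝟐 = s≤s z≤n

length-h≤2 : ∀ x → length (h x) ≤ 2
length-h≤2 𝟎 = ≤-refl
length-h≤2 𝟏 = ≤-refl
length-h≤2 𝟐 = s≤s z≤n

<length-h⇒<2 : ∀ {r} x → r < length (h x) → r < 2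
<length-h⇒<2 x r< = <-≤-trans r< (length-h≤2 x)

length≤length-hWord : ∀ w → length w ≤ length (hWord w)
length≤length-hWord [] = z≤n
length≤length-hWord (x ∷ w) rewrite length-++ (h x) {hWord w} =
  +-mono-≤ (1≤length-h x) (length≤length-hWord w)

count-++ : ∀ a u v → count a (u ++ v) ≡ count a u + count a v
count-++ a [] v = refl
count-++ a (x ∷ u) v rewrite count-++ a u v = sym (+-assoc _ (count a u) (count a v))

length-hWord : ∀ w → length (hWord w) + count 𝟐 w ≡ 2 * length w
length-hWord [] = refl
length-hWord (x ∷ w) = begin
  length (h x ++ hWord w) + count 𝟐 (x ∷ w)
    ≡⟨ cong₂ _+_ (length-++ (h x)) (count-++ 𝟐 (x ∷ []) w) ⟩
  length (h x) + length (hWord w) + (count 𝟐 (x ∷ []) + count 𝟐 w)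
    ≡⟨ interchange (length (h x)) (length (hWord w)) (count 𝟐 (x ∷ [])) (count 𝟐 w) ⟩
  (length (h x) + count 𝟐 (x ∷ [])) + (length (hWord w) + count 𝟐 w)
    ≡⟨ cong₂ _+_ (length-h x) (length-hWord w) ⟩
  2 + 2 * length w
    ≡⟨ *-suc 2 (length w) ⟨
  2 * suc (length w) ∎
  where
  open ≡-Reasoning
  length-h : ∀ x → length (h x) + count 𝟐 (x ∷ []) ≡ 2
  length-h 𝟎 = refl
  length-h 𝟏 = refl
  length-h 𝟐 = refl
  interchange : ∀ a b c d → a + b + (c + d) ≡ (a + c) + (b + d)
  interchange = solve-∀

count-hWord : ∀ a w → count a (hWord w) ≡ ∑ (λ b → count a (h b) * count b w)
count-hWord a [] = sym (zeros (count a (h 𝟎)) (count a (h 𝟏)) (count a (h 𝟐)))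
  where
  zeros : ∀ A B C → A * 0 + B * 0 + C * 0 ≡ 0
  zeros = solve-∀
count-hWord a (x ∷ w) = begin
  count a (h x ++ hWord w)                             ≡⟨ count-++ a (h x) (hWord w) ⟩
  count a (h x) + count a (hWord w)                    ≡⟨ cong (count a (h x) +_) (count-hWord a w) ⟩
  count a (h x) + ∑ (λ b → M b * count b w)            ≡⟨ column x ⟩
  ∑ (λ b → M b * count b (x ∷ w))                      ∎
  where
  open ≡-Reasoning
  M : Letter → ℕ
  M b = count a (h b)
  column₀ : ∀ A B C x y z → A + (A * x + B * y + C * z) ≡ A * suc x + B * y + C * z
  column₀ = solve-∀
  column₁ : ∀ A B C x y z → B + (A * x + B * y + C * z) ≡ A * x + B * suc y + C * z
  column₁ = solve-∀
  column₂ : ∀ A B C x y z → C + (A * x + B * y + C * z) ≡ A * x + B * y + C * suc z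
  column₂ = solve-∀
  column : ∀ x → M x + ∑ (λ b → M b * count b w) ≡ ∑ (λ b → M b * count b (x ∷ w))
  column 𝟎 = column₀ (M 𝟎) (M 𝟏) (M 𝟐) (count 𝟎 w) (count 𝟏 w) (count 𝟐 w)
  column 𝟏 = column₁ (M 𝟎) (M 𝟏) (M 𝟐) (count 𝟎 w) (count 𝟏 w) (count 𝟐 w)
  column 𝟐 = column₂ (M 𝟎) (M 𝟏) (M 𝟐) (count 𝟎 w) (count 𝟏 w) (count 𝟐 w)

count-hWord-gap : ∀ a {u v : List Letter} {g : Letter → ℕ} → (∀ b → count b u + 2 ≡ count b v + g b) →
  count a (hWord u) + 2 * ∑ (λ b → count a (h b)) ≡ count a (hWord v) + ∑ (λ b → count a (h b) * g b)
count-hWord-gap a {u} {v} {g} gaps = begin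
  count a (hWord u) + 2 * ∑ M
    ≡⟨ cong₂ _+_ (count-hWord a u) (trans (*-∑ 2 M) (∑-cong λ b → *-comm 2 (M b))) ⟩
  ∑ (λ b → M b * count b u) + ∑ (λ b → M b * 2)
    ≡⟨ ∑-+ (λ b → M b * count b u) (λ b → M b * 2) ⟨
  ∑ (λ b → M b * count b u + M b * 2)
    ≡⟨ ∑-cong (λ b → trans (sym (*-distribˡ-+ (M b) (count b u) 2))
                     (trans (cong (M b *_) (gaps b)) (*-distribˡ-+ (M b) (count b v) (g b)))) ⟩
  ∑ (λ b → M b * count b v + M b * g b)
    ≡⟨ ∑-+ (λ b → M b * count b v) (λ b → M b * g b) ⟩
  ∑ (λ b → M b * count b v) + ∑ (λ b → M b * g b)
    ≡⟨ cong (_+ ∑ (λ b → M b * g b)) (count-hWord a v) ⟨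
  count a (hWord v) + ∑ (λ b → M b * g b) ∎
  where
  open ≡-Reasoning
  M : Letter → ℕ
  M b = count a (h b)

length-factor : ∀ q n → length (factor q n) ≡ n
length-factor q zero = refl
length-factor q (suc n) = cong suc (length-factor (suc q) n)

length-hWord-factor : ∀ q n → length (hWord (factor q n)) + count 𝟐 (factor q n) ≡ 2 * n
length-hWord-factor q n = trans (length-hWord (factor q n)) (cong (2 *_) (length-factor q n))

factor-++ : ∀ q m n → factor q (m + n) ≡ factor q m ++ factor (q + m) n
factor-++ q zero n rewrite +-identityʳ q = refl
factor-++ q (suc m) n rewrite +-suc q m = cong (p q ∷_) (factor-++ (suc q) m n)

hWord-factor-++ : ∀ q m n → hWord (factor q (m + n)) ≡ hWord (factor q m) ++ hWord (factor (q + m) n)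
hWord-factor-++ q m n = trans (cong hWord (factor-++ q m n)) (concatMap-++ h (factor q m) (factor (q + m) n))

take-factor : ∀ q {r n} → r ≤ n → take r (factor q n) ≡ factor q r
take-factor q {zero} _ = refl
take-factor q {suc r} {suc n} (s≤s r≤n) = cong (p q ∷_) (take-factor (suc q) r≤n)

drop-factor : ∀ q {s n} → s ≤ n → drop s (factor q n) ≡ factor (q + s) (n ∸ s)
drop-factor q {zero} _ rewrite +-identityʳ q = refl
drop-factor q {suc s} {suc n} (s≤s s≤n) rewrite +-suc q s = drop-factor (suc q) s≤n

at-factor : ∀ q {t n} → t < n → at (factor q n) t ≡ p (q + t)
at-factor q {zero} {suc n} _ = cong p (sym (+-identityʳ q))
at-factor q {suc t} {suc n} (s≤s t<n) = trans (at-factor (suc q) t<n) (cong p (sym (+-suc q t)))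

at-++ˡ : ∀ u {v i} → i < length u → at (u ++ v) i ≡ at u i
at-++ˡ (x ∷ u) {i = zero} _ = refl
at-++ˡ (x ∷ u) {i = suc i} (s≤s i<u) = at-++ˡ u i<u

_occursAt_ : List Letter → ℕ → Set
w occursAt q = factor q (length w) ≡ w

occursAt-pointwise : ∀ w q → (∀ t → t < length w → at w t ≡ p (q + t)) → w occursAt q
occursAt-pointwise [] q _ = refl
occursAt-pointwise (x ∷ w) q at≡p = cong₂ _∷_ first rest
  where
  first : p q ≡ x
  first = trans (cong p (sym (+-identityʳ q))) (sym (at≡p 0 (s≤s z≤n)))
  rest : w occursAt suc q
  rest = occursAt-pointwise w (suc q) λ t t<w → trans (at≡p (suc t) (s≤s t<w)) (cong p (+-suc q t))

occursAt-++⁻ : ∀ u v q → (u ++ v) occursAt q → u occursAt q × v occursAt (q + length u)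
occursAt-++⁻ [] v q occ rewrite +-identityʳ q = refl , occ
occursAt-++⁻ (x ∷ u) v q occ
  with refl , occ′ ← ∷-injective occ
  with u-occ , v-occ ← occursAt-++⁻ u v (suc q) occ′
  rewrite +-suc q (length u) = cong (p q ∷_) u-occ , v-occ

occursAt-take : ∀ {w q r} → w occursAt q → r ≤ length w → factor q r ≡ take r w
occursAt-take {w} {q} occ r≤w = trans (sym (take-factor q r≤w)) (cong (take _) occ)

occursAt-at : ∀ {w q t} → w occursAt q → t < length w → p (q + t) ≡ at w t
occursAt-at {w} {q} {t} occ t<w = trans (sym (at-factor q t<w)) (cong (λ u → at u t) occ)

occursAt-window : ∀ {w q} s L → w occursAt q → s + L ≤ length w → factor (q + s) L ≡ take L (drop s w)
occursAt-window {w} {q} s L occ s+L≤w = begin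
  factor (q + s) L                             ≡⟨ take-factor (q + s) L≤w∸s ⟨
  take L (factor (q + s) (length w ∸ s))       ≡⟨ cong (take L) (drop-factor q s≤w) ⟨
  take L (drop s (factor q (length w)))        ≡⟨ cong (λ u → take L (drop s u)) occ ⟩
  take L (drop s w)                            ∎
  where
  open ≡-Reasoning
  s≤w : s ≤ length w
  s≤w = ≤-trans (m≤m+n s L) s+L≤w
  L≤w∸s : L ≤ length w ∸ s
  L≤w∸s = subst (_≤ length w ∸ s) (m+n∸m≡n s L) (∸-monoˡ-≤ s s+L≤w)

-- p = h(p)

hIter-suc : ∀ n → ∃[ t ] hIter (suc n) ≡ hIter n ++ t × 1 ≤ length t
hIter-suc zero = 𝟏 ∷ [] , refl , s≤s z≤n
hIter-suc (suc n) with t , eq , 1≤t ← hIter-suc n =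
  hWord t , trans (cong hWord eq) (concatMap-++ h (hIter n) t) , ≤-trans 1≤t (length≤length-hWord t)

hIter-+ : ∀ d n → ∃[ t ] hIter (d + n) ≡ hIter n ++ t
hIter-+ zero n = [] , sym (++-identityʳ (hIter n))
hIter-+ (suc d) n with t , eq ← hIter-+ d n | t′ , eq′ , _ ← hIter-suc (d + n) =
  t ++ t′ , trans eq′ (trans (cong (_++ t′) eq) (++-assoc (hIter n) t t′))

n<length-hIter : ∀ n → n < length (hIter n)
n<length-hIter zero = s≤s z≤n
n<length-hIter (suc n) with t , eq , 1≤t ← hIter-suc n rewrite eq | length-++ (hIter n) {t} =
  ≤-<-trans (n<length-hIter n) (m<m+n (length (hIter n)) 1≤t)

hIter-occursAt : ∀ n → hIter n occursAt 0
hIter-occursAt n = occursAt-pointwise (hIter n) 0 λ t t<n →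
  let s , eq = hIter-+ (suc t) n
      s′ , eq′ = hIter-+ n (suc t)
  in begin
    at (hIter n) t                 ≡⟨ at-++ˡ (hIter n) t<n ⟨
    at (hIter n ++ s) t            ≡⟨ cong (λ u → at u t) eq ⟨
    at (hIter (suc t + n)) t       ≡⟨ cong (λ d → at (hIter d) t) (+-comm (suc t) n) ⟩
    at (hIter (n + suc t)) t       ≡⟨ cong (λ u → at u t) eq′ ⟩
    at (hIter (suc t) ++ s′) t     ≡⟨ at-++ˡ (hIter (suc t)) (<-trans (n<1+n t) (n<length-hIter (suc t))) ⟩
    p t                            ∎
  where open ≡-Reasoning

hWord-prefix-occursAt : ∀ k → hWord (factor 0 k) occursAt 0
hWord-prefix-occursAt k = subst (_occursAt 0) (cong hWord prefix) (proj₁ (occursAt-++⁻ _ _ 0 image))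
  where
  X = hIter k
  prefix : take k X ≡ factor 0 k
  prefix = sym (occursAt-take (hIter-occursAt k) (<⇒≤ (n<length-hIter k)))
  split : hWord X ≡ hWord (take k X) ++ hWord (drop k X)
  split = trans (cong hWord (sym (take++drop≡id k X))) (concatMap-++ h (take k X) (drop k X))
  image : (hWord (take k X) ++ hWord (drop k X)) occursAt 0
  image = subst (_occursAt 0) split (hIter-occursAt (suc k))

pos : ℕ → ℕ
pos k = length (hWord (factor 0 k))

hWord-factor-occursAt : ∀ k n → hWord (factor k n) occursAt pos k
hWord-factor-occursAt k n =
  proj₂ (occursAt-++⁻ _ _ 0 (subst (_occursAt 0) (hWord-factor-++ 0 k n) (hWord-prefix-occursAt (k + n))))

h-occursAt : ∀ k → h (p k) occursAt pos k
h-occursAt k = subst (_occursAt pos k) (++-identityʳ (h (p k))) (hWord-factor-occursAt k 1)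

pos-+ : ∀ k n → pos (k + n) ≡ pos k + length (hWord (factor k n))
pos-+ k n = trans (cong length (hWord-factor-++ 0 k n)) (length-++ (hWord (factor 0 k)))

pos-suc : ∀ k → pos (suc k) ≡ pos k + length (h (p k))
pos-suc k = begin
  pos (suc k)                            ≡⟨ cong pos (+-comm 1 k) ⟩
  pos (k + 1)                            ≡⟨ pos-+ k 1 ⟩
  pos k + length (h (p k) ++ [])         ≡⟨ cong (λ u → pos k + length u) (++-identityʳ (h (p k))) ⟩
  pos k + length (h (p k))               ∎
  where open ≡-Reasoning

suc<pos-suc : ∀ k → suc k < pos (suc k)
suc<pos-suc zero = s≤s (s≤s z≤n)
suc<pos-suc (suc k) rewrite pos-suc (suc k) =
  subst (_≤ pos (suc k) + length (h (p (suc k)))) (+-comm (suc (suc k)) 1)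
        (+-mono-≤ (suc<pos-suc k) (1≤length-h (p (suc k))))

record Ancestry (k n : ℕ) : Set where
  constructor ancestry
  field
    distance offset : ℕ
    position : pos (k + distance) + offset ≡ n
    offset<  : offset < length (h (p (k + distance)))

ancestry-start : ∀ {k n} → pos k ≡ n → Ancestry k n
ancestry-start {k} refl =
  ancestry 0 0 (trans (+-identityʳ _) (cong pos (+-identityʳ k))) (1≤length-h (p (k + 0)))

ancestry-suc : ∀ {k n} → Ancestry k n → Ancestry k (suc n)
ancestry-suc {k} {n} (ancestry d r eq r<) with suc r <? length (h (p (k + d)))
... | yes r+1< = ancestry d (suc r) (trans (+-suc _ r) (cong suc eq)) r+1<
... | no  r+1≮ = ancestry (suc d) 0 next (1≤length-h (p (k + suc d)))
  where
  next : pos (k + suc d) + 0 ≡ suc n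
  next = begin
    pos (k + suc d) + 0            ≡⟨ +-identityʳ _ ⟩
    pos (k + suc d)                ≡⟨ cong pos (+-suc k d) ⟩
    pos (suc (k + d))              ≡⟨ pos-suc (k + d) ⟩
    pos (k + d) + length (h (p (k + d))) ≡⟨ cong (pos (k + d) +_) (≤-antisym r< (≮⇒≥ r+1≮)) ⟨
    pos (k + d) + suc r            ≡⟨ +-suc _ r ⟩
    suc (pos (k + d) + r)          ≡⟨ cong suc eq ⟩
    suc n                          ∎
    where open ≡-Reasoning

locate : ∀ k n → pos k ≤ n → Ancestry k n
locate k zero pos≤0 = ancestry-start (n≤0⇒n≡0 pos≤0)
locate k (suc n) pos≤n+1 with pos k ≤? n
... | yes pos≤n = ancestry-suc (locate k n pos≤n)
... | no  pos≰n = ancestry-start (≤-antisym pos≤n+1 (≰⇒> pos≰n))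

ancestor< : ∀ {k r n} → pos k + r ≡ suc n → k < suc n
ancestor< {zero} _ = s≤s z≤n
ancestor< {suc k} {r} eq = <-≤-trans (suc<pos-suc k) (subst (pos (suc k) ≤_) eq (m≤m+n _ r))

-- Desubstituting windows

window-span : ∀ {k n r r′ i m} → pos k + r ≡ i → pos (k + n) + r′ ≡ i + m →
  r + m ≡ length (hWord (factor k n)) + r′
window-span {k} {n} {r} {r′} {i} {m} start end = +-cancelˡ-≡ (pos k) _ _ (begin
  pos k + (r + m)                           ≡⟨ +-assoc (pos k) r m ⟨
  pos k + r + m                             ≡⟨ cong (_+ m) start ⟩
  i + m                                     ≡⟨ end ⟨
  pos (k + n) + r′                          ≡⟨ cong (_+ r′) (pos-+ k n) ⟩
  pos k + length (hWord (factor k n)) + r′  ≡⟨ +-assoc (pos k) _ r′ ⟩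
  pos k + (length (hWord (factor k n)) + r′) ∎)
  where open ≡-Reasoning

window-desubstitution : ∀ {k n r r′ i m} → pos k + r ≡ i → r ≤ length (h (p k)) →
  pos (k + n) + r′ ≡ i + m → r′ ≤ length (h (p (k + n))) →
  take r (h (p k)) ++ factor i m ≡ hWord (factor k n) ++ take r′ (h (p (k + n)))
window-desubstitution {k} {n} {r} {r′} {i} {m} start r≤ end r′≤ = begin
  take r (h (p k)) ++ factor i m
    ≡⟨ cong₂ _++_ (occursAt-take (h-occursAt k) r≤) (cong (λ q → factor q m) start) ⟨
  factor (pos k) r ++ factor (pos k + r) m
    ≡⟨ factor-++ (pos k) r m ⟨
  factor (pos k) (r + m)
    ≡⟨ cong (factor (pos k)) (window-span {k} {n} start end) ⟩
  factor (pos k) (L + r′)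
    ≡⟨ factor-++ (pos k) L r′ ⟩
  factor (pos k) L ++ factor (pos k + L) r′
    ≡⟨ cong₂ _++_ (hWord-factor-occursAt k n)
                  (trans (cong (λ q → factor q r′) (sym (pos-+ k n))) (occursAt-take (h-occursAt (k + n)) r′≤)) ⟩
  hWord (factor k n) ++ take r′ (h (p (k + n))) ∎
  where
  open ≡-Reasoning
  L = length (hWord (factor k n))

window-count : ∀ {k n r r′ i m} → pos k + r ≡ i → r ≤ length (h (p k)) →
  pos (k + n) + r′ ≡ i + m → r′ ≤ length (h (p (k + n))) → ∀ a →
  count a (take r (h (p k))) + count a (factor i m) ≡ count a (hWord (factor k n)) + count a (take r′ (h (p (k + n))))
window-count {k} {n} {r} {r′} {i} {m} start r≤ end r′≤ a = begin
  count a (take r (h (p k))) + count a (factor i m)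
    ≡⟨ count-++ a (take r (h (p k))) (factor i m) ⟨
  count a (take r (h (p k)) ++ factor i m)
    ≡⟨ cong (count a) (window-desubstitution {k} {n} start r≤ end r′≤) ⟩
  count a (hWord (factor k n) ++ take r′ (h (p (k + n))))
    ≡⟨ count-++ a (hWord (factor k n)) (take r′ (h (p (k + n)))) ⟩
  count a (hWord (factor k n)) + count a (take r′ (h (p (k + n)))) ∎
  where open ≡-Reasoning

-- Both identities come from a ring identity by cancelling the sum of the hypotheses.
gap-arithmetic : ∀ {x y U V T₁ T₁′ T₂ E T₂′ M G} →
  T₁ + x ≡ U + T₁′ → T₂ + y ≡ V + (E + T₂′) → U + 2 * M ≡ V + G →
  x + 2 + (2 * M + T₁ + E + T₂′) ≡ y + (2 + G + T₁′ + T₂)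
gap-arithmetic {x} {y} {U} {V} {T₁} {T₁′} {T₂} {E} {T₂′} {M} {G} eqᵘ eqᵛ eqᴹ =
  +-cancelʳ-≡ ((U + T₁′) + (T₂ + y) + (V + G)) _ _
    (trans (rearrange x y U V T₁ T₁′ T₂ E T₂′ M G)
           (cong (y + (2 + G + T₁′ + T₂) +_) (cong₂ _+_ (cong₂ _+_ eqᵘ (sym eqᵛ)) eqᴹ)))
  where
  rearrange : ∀ x y U V T₁ T₁′ T₂ E T₂′ M G →
    x + 2 + (2 * M + T₁ + E + T₂′) + ((U + T₁′) + (T₂ + y) + (V + G)) ≡
    y + (2 + G + T₁′ + T₂) + ((T₁ + x) + (V + (E + T₂′)) + (U + 2 * M))
  rearrange = solve-∀

length-arithmetic : ∀ {r₁ r₁′ r₂ r₂′ m Lᵘ Lᵛ D cᵘ cᵛ g} →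
  r₁ + m ≡ Lᵘ + r₁′ → r₂ + m ≡ Lᵛ + (D + r₂′) → Lᵘ + cᵘ ≡ Lᵛ + cᵛ → cᵘ + 2 ≡ cᵛ + g →
  2 + r₁′ + r₂ ≡ D + r₂′ + r₁ + g
length-arithmetic {r₁} {r₁′} {r₂} {r₂′} {m} {Lᵘ} {Lᵛ} {D} {cᵘ} {cᵛ} {g} spanᵘ spanᵛ lengths gap₂ =
  +-cancelʳ-≡ ((Lᵘ + r₁′) + (r₂ + m) + (Lᵛ + cᵛ) + (cᵘ + 2)) _ _
    (trans (cong (2 + r₁′ + r₂ +_) (cong₂ _+_ (cong₂ _+_ (cong₂ _+_ (sym spanᵘ) spanᵛ) (sym lengths)) gap₂))
           (rearrange r₁ r₁′ r₂ r₂′ m Lᵘ Lᵛ D cᵘ cᵛ g))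
  where
  rearrange : ∀ r₁ r₁′ r₂ r₂′ m Lᵘ Lᵛ D cᵘ cᵛ g →
    2 + r₁′ + r₂ + ((r₁ + m) + (Lᵛ + (D + r₂′)) + (Lᵘ + cᵘ) + (cᵛ + g)) ≡
    D + r₂′ + r₁ + g + ((Lᵘ + r₁′) + (r₂ + m) + (Lᵛ + cᵛ) + (cᵘ + 2))
  rearrange = solve-∀

excess<5 : ∀ {q δ r₁ r₁′ r₂ r₂′ g} → r₁′ < 2 → r₂ < 2 →
  2 + r₁′ + r₂ ≡ length (hWord (factor q δ)) + r₂′ + r₁ + g → δ < 5
excess<5 {q} {δ} {r₁} {r₁′} {r₂} {r₂′} {g} r₁′<2 r₂<2 balance = s≤s (begin
  δ                       ≡⟨ length-factor q δ ⟨
  length (factor q δ)     ≤⟨ length≤length-hWord (factor q δ) ⟩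
  D                       ≤⟨ m≤m+n D r₂′ ⟩
  D + r₂′                 ≤⟨ m≤m+n (D + r₂′) r₁ ⟩
  D + r₂′ + r₁            ≤⟨ m≤m+n (D + r₂′ + r₁) g ⟩
  D + r₂′ + r₁ + g        ≡⟨ balance ⟨
  2 + r₁′ + r₂            ≤⟨ +-mono-≤ (+-monoʳ-≤ 2 (≤-pred r₁′<2)) (≤-pred r₂<2) ⟩
  4                       ∎)
  where
  open ≤-Reasoning
  D = length (hWord (factor q δ))

gap-∸ : ∀ {x y L G} → x + 2 + L ≡ y + G → L ≤ G → x + 2 ≡ y + (G ∸ L)
gap-∸ {x} {y} {L} {G} eq L≤G =
  +-cancelʳ-≡ L _ _ (trans eq (trans (cong (y +_) (sym (m∸n+n≡m L≤G))) (sym (+-assoc y (G ∸ L) L))))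

swap-gap : ∀ {x y g} → x + 2 ≡ y + g → g ≤ 4 → y + 2 ≡ x + (4 ∸ g)
swap-gap {x} {y} {g} eq g≤4 = +-cancelʳ-≡ g _ _ (begin
  y + 2 + g          ≡⟨ +-assoc y 2 g ⟩
  y + (2 + g)        ≡⟨ cong (y +_) (+-comm 2 g) ⟩
  y + (g + 2)        ≡⟨ +-assoc y g 2 ⟨
  y + g + 2          ≡⟨ cong (_+ 2) eq ⟨
  x + 2 + 2          ≡⟨ +-assoc x 2 2 ⟩
  x + 4              ≡⟨ cong (x +_) (m∸n+n≡m g≤4) ⟨
  x + (4 ∸ g + g)    ≡⟨ +-assoc x (4 ∸ g) g ⟨
  x + (4 ∸ g) + g    ∎)
  where open ≡-Reasoning

diffLe-gap : ∀ {x y g} → x + 2 ≡ y + g → g ≤ 4 → diffLe 2 x y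
diffLe-gap {x} {y} {g} eq g≤4 =
  +-cancelʳ-≤ 2 x (y + 2) (subst (_≤ y + 2 + 2) (sym eq) (subst (y + g ≤_) (sym (+-assoc y 2 2)) (+-monoʳ-≤ y g≤4))) ,
  subst (y ≤_) (sym eq) (m≤m+n y g)

-- The automaton

factors₅ : List (List Letter)
factors₅ =
  (𝟎 ∷ 𝟏 ∷ 𝟎 ∷ 𝟐 ∷ 𝟏 ∷ []) ∷ (𝟎 ∷ 𝟏 ∷ 𝟐 ∷ 𝟏 ∷ 𝟎 ∷ []) ∷ (𝟎 ∷ 𝟐 ∷ 𝟏 ∷ 𝟎 ∷ 𝟏 ∷ []) ∷
  (𝟏 ∷ 𝟎 ∷ 𝟏 ∷ 𝟎 ∷ 𝟐 ∷ []) ∷ (𝟏 ∷ 𝟎 ∷ 𝟏 ∷ 𝟐 ∷ 𝟏 ∷ []) ∷ (𝟏 ∷ 𝟎 ∷ 𝟐 ∷ 𝟏 ∷ 𝟎 ∷ []) ∷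
  (𝟏 ∷ 𝟐 ∷ 𝟏 ∷ 𝟎 ∷ 𝟏 ∷ []) ∷ (𝟏 ∷ 𝟐 ∷ 𝟏 ∷ 𝟎 ∷ 𝟐 ∷ []) ∷ (𝟐 ∷ 𝟏 ∷ 𝟎 ∷ 𝟏 ∷ 𝟎 ∷ []) ∷
  (𝟐 ∷ 𝟏 ∷ 𝟎 ∷ 𝟏 ∷ 𝟐 ∷ []) ∷ (𝟐 ∷ 𝟏 ∷ 𝟎 ∷ 𝟐 ∷ 𝟏 ∷ []) ∷ []

-- For a pair of windows u, v, gap a stands for |u|ₐ − |v|ₐ + 2 (see Describes).
record State : Set where
  constructor state
  field
    gap₀ gap₁ gap₂ : ℕ
    firstᵘ firstᵛ : Letter
    nextᵘ nextᵛ : List Letter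

open State

gap : State → Letter → ℕ
gap s 𝟎 = gap₀ s
gap s 𝟏 = gap₁ s
gap s 𝟐 = gap₂ s

_≟ˢ_ : DecidableEquality State
state a b c x y u v ≟ˢ state a′ b′ c′ x′ y′ u′ v′ =
  map′ (λ { (refl , refl , refl , refl , refl , refl , refl) → refl })
       (λ { refl → refl , refl , refl , refl , refl , refl , refl })
       (a ℕ.≟ a′ ×-dec b ℕ.≟ b′ ×-dec c ℕ.≟ c′ ×-dec x Fin.≟ x′ ×-dec y Fin.≟ y′ ×-dec
        ≡-dec Fin._≟_ u u′ ×-dec ≡-dec Fin._≟_ v v′)

swap : State → State
swap (state a b c x y u v) = state (4 ∸ a) (4 ∸ b) (4 ∸ c) y x v u

initial : List Letter → List Letter → State
initial u v = state 2 2 2 (at u 0) (at v 0) u v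

-- The new u-window is h(u), minus its first leftᵘ letters, followed by the first rightᵘ letters of
-- h(lastᵘ); the new v-window is h(v) followed by h of the first `excess` letters after v, trimmed
-- in the same way.
record Cut : Set where
  constructor cut
  field
    leftᵘ rightᵘ leftᵛ rightᵛ excess : ℕ

open Cut

extra : State → Cut → List Letter
extra s c = hWord (take (excess c) (nextᵛ s))

lastᵘ lastᵛ : State → Cut → Letter
lastᵘ s c = at (nextᵘ s) 0
lastᵛ s c = at (nextᵛ s) (excess c)

-- The last conjunct says that the two new windows have the same length.
fits : State → Cut → Bool
fits s c =
  (leftᵘ c <ᵇ length (h (firstᵘ s))) ∧ (rightᵘ c <ᵇ length (h (lastᵘ s c))) ∧
  (leftᵛ c <ᵇ length (h (firstᵛ s))) ∧ (rightᵛ c <ᵇ length (h (lastᵛ s c))) ∧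
  (2 + rightᵘ c + leftᵛ c ≡ᵇ length (extra s c) + rightᵛ c + leftᵘ c + gap₂ s)

gain loss : State → Cut → Letter → ℕ
gain s c a =
  2 + ∑ (λ b → count a (h b) * gap s b) + count a (take (rightᵘ c) (h (lastᵘ s c)))
    + count a (take (leftᵛ c) (h (firstᵛ s)))
loss s c a =
  2 * ∑ (λ b → count a (h b)) + count a (take (leftᵘ c) (h (firstᵘ s))) + count a (extra s c)
    + count a (take (rightᵛ c) (h (lastᵛ s c)))

successor : State → Cut → State
successor s c =
  state (gain s c 𝟎 ∸ loss s c 𝟎) (gain s c 𝟏 ∸ loss s c 𝟏) (gain s c 𝟐 ∸ loss s c 𝟐)
        (at (h (firstᵘ s)) (leftᵘ c)) (at (h (firstᵛ s)) (leftᵛ c))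
        (take 5 (drop (rightᵘ c) (hWord (nextᵘ s)))) (take 5 (drop (length (extra s c) + rightᵛ c) (hWord (nextᵛ s))))

gap-successor : ∀ s c a → gap (successor s c) a ≡ gain s c a ∸ loss s c a
gap-successor s c 𝟎 = refl
gap-successor s c 𝟏 = refl
gap-successor s c 𝟐 = refl

index₅ : List Letter → ℕ
index₅ w = go factors₅
  where
  go : List (List Letter) → ℕ
  go [] = 0
  go (v ∷ vs) = if ⌊ ≡-dec Fin._≟_ v w ⌋ then 0 else suc (go vs)

lookup₅ : ℕ → List Letter
lookup₅ = go factors₅
  where
  go : List (List Letter) → ℕ → List Letter
  go [] _ = []
  go (v ∷ _) zero = v
  go (_ ∷ vs) (suc k) = go vs k

letter : ℕ → Letter
letter 0 = 𝟎
letter 1 = 𝟏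
letter _ = 𝟐

code : State → ℕ
code (state a b c x y u v) = a + 5 * (b + 5 * (c + 5 * (toℕ x + 3 * (toℕ y + 3 * (index₅ u + 11 * index₅ v)))))

decode : ℕ → State
decode n = state (n % 5) (n₁ % 5) (n₂ % 5) (letter (n₃ % 3)) (letter (n₄ % 3)) (lookup₅ (n₅ % 11)) (lookup₅ (n₅ / 11))
  where
  n₁ = n / 5
  n₂ = n₁ / 5
  n₃ = n₂ / 5
  n₄ = n₃ / 3
  n₅ = n₄ / 3

balanced : ℕ → List ℕ → Tree ℕ ⊤
balanced zero _ = leaf tt
balanced (suc d) xs with drop (length xs / 2) xs
... | [] = leaf tt
... | k ∷ ys = node (balanced d (take (length xs / 2) xs)) k (balanced d ys)

member : ℕ → Tree ℕ ⊤ → Bool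
member n (leaf _) = false
member n (node l k r) = (n ≡ᵇ k) ∨ (if n <ᵇ k then member n l else member n r)

-- States are stored by their codes; decoding the code again makes the test sound without
-- any injectivity property of code.
known : Tree ℕ ⊤ → State → Bool
known t s = member (code s) t ∧ ⌊ decode (code s) ≟ˢ s ⌋

successorOK : Tree ℕ ⊤ → State → Cut → Bool
successorOK t s c =
  all (λ a → loss s c a ≤ᵇ gain s c a) (allFin 3) ∧
  (rightᵘ c + 5 ≤ᵇ length (hWord (nextᵘ s))) ∧ (length (extra s c) + rightᵛ c + 5 ≤ᵇ length (hWord (nextᵛ s))) ∧
  known t (successor s c)

allCuts : (Cut → Bool) → Bool
allCuts g =
  all (λ r₁ → all (λ r₁′ → all (λ r₂ → all (λ r₂′ → all (λ δ → g (cut r₁ r₁′ r₂ r₂′ δ))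
    (upTo 5)) (upTo 2)) (upTo 2)) (upTo 2)) (upTo 2)

stepOK : Tree ℕ ⊤ → State → Cut → Bool
stepOK t s c = not (fits s c) ∨ successorOK t s c

gapsOK : State → Bool
gapsOK s = all (λ a → gap s a ≤ᵇ 4) (allFin 3)

stateOK : Tree ℕ ⊤ → State → Bool
stateOK t s = gapsOK s ∧ known t (swap s) ∧ allCuts (stepOK t s)

statesOK : Tree ℕ ⊤ → List ℕ → Bool
statesOK t codes = all (λ n → stateOK t (decode n)) codes

initialsOK : Tree ℕ ⊤ → List (List Letter) → Bool
initialsOK t ws = all (λ u → all (λ v → known t (initial u v)) ws) ws

windowsClosed : List (List Letter) → Bool
windowsClosed ws =
  all (λ w → all (λ r → not (r <ᵇ length (h (at w 0))) ∨
                          ((r + 5 ≤ᵇ length (hWord w)) ∧ ⌊ take 5 (drop r (hWord w)) ∈? ws ⌋))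
                 (upTo 2))
      ws

T-∧⁻ : ∀ {x y} → T (x ∧ y) → T x × T y
T-∧⁻ = Equivalence.to T-∧

T-not-∨⁻ : ∀ {x y} → T (not x ∨ y) → T x → T y
T-not-∨⁻ {true} y _ = y

all-sound : ∀ {A : Set} (f : A → Bool) {xs x} → T (all f xs) → x ∈ xs → T (f x)
all-sound f {xs} chk = All.lookup (all⁺ f xs chk)

member-balanced : ∀ d xs {n} → T (member n (balanced d xs)) → n ∈ xs
member-balanced zero xs ()
member-balanced (suc d) xs {n} found
  with drop (length xs / 2) xs | take++drop≡id (length xs / 2) xs
member-balanced (suc d) xs {n} () | [] | _
... | k ∷ ys | split with n ≡ᵇ k in n≡ᵇk | n <ᵇ k
...   | true  | _     = subst (n ∈_) split (∈-++⁺ʳ _ (here (≡ᵇ⇒≡ n k (subst T (sym n≡ᵇk) tt))))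
...   | false | true  = subst (n ∈_) split (∈-++⁺ˡ (member-balanced d _ found))
...   | false | false = subst (n ∈_) split (∈-++⁺ʳ _ (there (member-balanced d ys found)))

known-stateOK : ∀ d codes t s → statesOK t codes ≡ true →
  T (member (code s) (balanced d codes)) → T ⌊ decode (code s) ≟ˢ s ⌋ → T (stateOK t s)
known-stateOK d codes t s ok found decoded =
  subst (T ∘ stateOK t) (toWitness decoded)
    (all-sound (λ n → stateOK t (decode n)) (Equivalence.from T-≡ ok) (member-balanced d codes found))

initial-known : ∀ t ws {u v} → initialsOK t ws ≡ true → u ∈ ws → v ∈ ws → T (known t (initial u v))
initial-known t ws {u} ok u∈ v∈ =
  all-sound (λ v → known t (initial u v))
    (all-sound (λ u → all (λ v → known t (initial u v)) ws) (Equivalence.from T-≡ ok) u∈) v∈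

allCuts-sound : ∀ g {r₁ r₁′ r₂ r₂′ δ} → T (allCuts g) →
  r₁ < 2 → r₁′ < 2 → r₂ < 2 → r₂′ < 2 → δ < 5 → T (g (cut r₁ r₁′ r₂ r₂′ δ))
allCuts-sound g {r₁} {r₁′} {r₂} {r₂′} ok r₁< r₁′< r₂< r₂′< δ< =
  pick (λ δ → g (cut r₁ r₁′ r₂ r₂′ δ)) δ<
  (pick (λ r₂′ → all (λ δ → g (cut r₁ r₁′ r₂ r₂′ δ)) (upTo 5)) r₂′<
  (pick (λ r₂ → all (λ r₂′ → all (λ δ → g (cut r₁ r₁′ r₂ r₂′ δ)) (upTo 5)) (upTo 2)) r₂<
  (pick (λ r₁′ → all (λ r₂ → all (λ r₂′ → all (λ δ → g (cut r₁ r₁′ r₂ r₂′ δ)) (upTo 5)) (upTo 2)) (upTo 2)) r₁′<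
  (pick (λ r₁ → all (λ r₁′ → all (λ r₂ → all (λ r₂′ → all (λ δ → g (cut r₁ r₁′ r₂ r₂′ δ))
                   (upTo 5)) (upTo 2)) (upTo 2)) (upTo 2)) r₁< ok))))
  where
  pick : ∀ (f : ℕ → Bool) {n k} → k < n → T (all f (upTo n)) → T (f k)
  pick f {n} k<n chk = all-sound f {upTo n} chk (∈-upTo⁺ k<n)

stateOK-gaps : ∀ t s → T (stateOK t s) → ∀ a → gap s a ≤ 4
stateOK-gaps t s ok a =
  ≤ᵇ⇒≤ (gap s a) 4 (all-sound (λ a → gap s a ≤ᵇ 4) {allFin 3} (proj₁ (T-∧⁻ {gapsOK s} ok)) (∈-allFin a))

stateOK-swap : ∀ t s → T (stateOK t s) → T (known t (swap s))
stateOK-swap t s ok = proj₁ (T-∧⁻ {known t (swap s)} (proj₂ (T-∧⁻ {gapsOK s} ok)))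

stateOK-successor : ∀ t s {r₁ r₁′ r₂ r₂′ δ} → T (stateOK t s) →
  r₁ < 2 → r₁′ < 2 → r₂ < 2 → r₂′ < 2 → δ < 5 → T (fits s (cut r₁ r₁′ r₂ r₂′ δ)) →
  T (successorOK t s (cut r₁ r₁′ r₂ r₂′ δ))
stateOK-successor t s {r₁} {r₁′} {r₂} {r₂′} {δ} ok r₁< r₁′< r₂< r₂′< δ< =
  T-not-∨⁻ {fits s c} {successorOK t s c} (allCuts-sound (stepOK t s) steps r₁< r₁′< r₂< r₂′< δ<)
  where
  c = cut r₁ r₁′ r₂ r₂′ δ
  steps : T (allCuts (stepOK t s))
  steps = proj₂ (T-∧⁻ {known t (swap s)} {allCuts (stepOK t s)}
                  (proj₂ (T-∧⁻ {gapsOK s} {known t (swap s) ∧ allCuts (stepOK t s)} ok)))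

successorOK-sound : ∀ t s c → T (successorOK t s c) →
  (∀ a → loss s c a ≤ gain s c a) × rightᵘ c + 5 ≤ length (hWord (nextᵘ s)) ×
  length (extra s c) + rightᵛ c + 5 ≤ length (hWord (nextᵛ s)) × T (known t (successor s c))
successorOK-sound t s c ok =
  let losses , ok₁ = T-∧⁻ {all (λ a → loss s c a ≤ᵇ gain s c a) (allFin 3)}
                          {roomᵘ ∧ roomᵛ ∧ known t (successor s c)} ok
      fitᵘ , ok₂ = T-∧⁻ {roomᵘ} {roomᵛ ∧ known t (successor s c)} ok₁
      fitᵛ , known′ = T-∧⁻ {roomᵛ} {known t (successor s c)} ok₂
  in (λ a → ≤ᵇ⇒≤ (loss s c a) (gain s c a)
              (all-sound (λ a → loss s c a ≤ᵇ gain s c a) {allFin 3} losses (∈-allFin a)))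
   , ≤ᵇ⇒≤ (rightᵘ c + 5) _ fitᵘ , ≤ᵇ⇒≤ (length (extra s c) + rightᵛ c + 5) _ fitᵛ , known′
  where
  roomᵘ roomᵛ : Bool
  roomᵘ = rightᵘ c + 5 ≤ᵇ length (hWord (nextᵘ s))
  roomᵛ = length (extra s c) + rightᵛ c + 5 ≤ᵇ length (hWord (nextᵛ s))

fits-intro : ∀ {s c} → leftᵘ c < length (h (firstᵘ s)) → rightᵘ c < length (h (lastᵘ s c)) →
  leftᵛ c < length (h (firstᵛ s)) → rightᵛ c < length (h (lastᵛ s c)) →
  2 + rightᵘ c + leftᵛ c ≡ length (extra s c) + rightᵛ c + leftᵘ c + gap₂ s → T (fits s c)
fits-intro r₁< r₁′< r₂< r₂′< balance =
  Equivalence.from T-∧ (<⇒<ᵇ r₁< , Equivalence.from T-∧ (<⇒<ᵇ r₁′< , Equivalence.from T-∧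
    (<⇒<ᵇ r₂< , Equivalence.from T-∧ (<⇒<ᵇ r₂′< , ≡⇒≡ᵇ _ _ balance))))

windows-sound : ∀ ws {w r} → windowsClosed ws ≡ true → w ∈ ws → r < length (h (at w 0)) →
  r + 5 ≤ length (hWord w) × take 5 (drop r (hWord w)) ∈ ws
windows-sound ws {w} {r} ok w∈ r<h =
  ≤ᵇ⇒≤ (r + 5) _ (proj₁ window) , toWitness (proj₂ window)
  where
  next : List Letter → ℕ → Bool
  next w r = not (r <ᵇ length (h (at w 0))) ∨ ((r + 5 ≤ᵇ length (hWord w)) ∧ ⌊ take 5 (drop r (hWord w)) ∈? ws ⌋)
  checked : T (next w r)
  checked = all-sound (next w) {upTo 2} (all-sound (λ w → all (next w) (upTo 2)) {ws} (Equivalence.from T-≡ ok) w∈)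
                      (∈-upTo⁺ (<length-h⇒<2 (at w 0) r<h))
  window : T (r + 5 ≤ᵇ length (hWord w)) × T ⌊ take 5 (drop r (hWord w)) ∈? ws ⌋
  window = T-∧⁻ {r + 5 ≤ᵇ length (hWord w)} (T-not-∨⁻ {r <ᵇ length (h (at w 0))} checked (<⇒<ᵇ r<h))

reachableCodes : List ℕ
reachableCodes =
  38 ∷ 62 ∷ 86 ∷ 167 ∷ 187 ∷ 191 ∷ 211 ∷ 312 ∷ 316 ∷ 336 ∷ 413 ∷ 433 ∷
  437 ∷ 457 ∷ 538 ∷ 562 ∷ 586 ∷ 683 ∷ 687 ∷ 707 ∷ 711 ∷ 788 ∷ 808 ∷ 812 ∷
  913 ∷ 917 ∷ 937 ∷ 941 ∷ 1062 ∷ 1163 ∷ 1183 ∷ 1187 ∷ 1288 ∷ 1292 ∷ 1312 ∷ 1316 ∷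
  1336 ∷ 1437 ∷ 1461 ∷ 1534 ∷ 1538 ∷ 1558 ∷ 1562 ∷ 1582 ∷ 1663 ∷ 1683 ∷ 1687 ∷ 1711 ∷
  1808 ∷ 1812 ∷ 1832 ∷ 1836 ∷ 1909 ∷ 1913 ∷ 1933 ∷ 1937 ∷ 2038 ∷ 2042 ∷ 2062 ∷ 2163 ∷
  2183 ∷ 2187 ∷ 2288 ∷ 2292 ∷ 2312 ∷ 2413 ∷ 2417 ∷ 2437 ∷ 2441 ∷ 2542 ∷ 2562 ∷ 2566 ∷
  2586 ∷ 2659 ∷ 2663 ∷ 2683 ∷ 2687 ∷ 2707 ∷ 2788 ∷ 2792 ∷ 2812 ∷ 2836 ∷ 2913 ∷ 2933 ∷
  2937 ∷ 2957 ∷ 2961 ∷ 3038 ∷ 3062 ∷ 3143 ∷ 3163 ∷ 3167 ∷ 3187 ∷ 3191 ∷ 3288 ∷ 3292 ∷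
  3312 ∷ 3433 ∷ 3437 ∷ 3457 ∷ 3538 ∷ 3562 ∷ 3586 ∷ 3687 ∷ 3707 ∷ 3711 ∷ 3808 ∷ 3828 ∷
  3832 ∷ 3913 ∷ 3933 ∷ 3937 ∷ 3957 ∷ 3961 ∷ 4058 ∷ 4082 ∷ 4159 ∷ 4163 ∷ 4183 ∷ 4187 ∷
  4288 ∷ 4308 ∷ 4312 ∷ 4433 ∷ 4437 ∷ 4457 ∷ 4538 ∷ 4558 ∷ 4562 ∷ 4582 ∷ 4663 ∷ 4683 ∷
  4687 ∷ 4711 ∷ 4808 ∷ 4812 ∷ 4832 ∷ 4836 ∷ 4909 ∷ 4929 ∷ 4933 ∷ 4953 ∷ 4957 ∷ 5034 ∷
  5038 ∷ 5058 ∷ 5062 ∷ 5082 ∷ 5183 ∷ 5203 ∷ 5207 ∷ 5284 ∷ 5288 ∷ 5308 ∷ 5409 ∷ 5413 ∷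
  5433 ∷ 5437 ∷ 5558 ∷ 5562 ∷ 5582 ∷ 5663 ∷ 5683 ∷ 5687 ∷ 5707 ∷ 5788 ∷ 5792 ∷ 5812 ∷
  5836 ∷ 5933 ∷ 5937 ∷ 5957 ∷ 5961 ∷ 6034 ∷ 6058 ∷ 6082 ∷ 6159 ∷ 6163 ∷ 6183 ∷ 6187 ∷
  6207 ∷ 6211 ∷ 6308 ∷ 6312 ∷ 6332 ∷ 6409 ∷ 6413 ∷ 6433 ∷ 6437 ∷ 6538 ∷ 6562 ∷ 6663 ∷
  6683 ∷ 6687 ∷ 6784 ∷ 6788 ∷ 6808 ∷ 6812 ∷ 6913 ∷ 6937 ∷ 7058 ∷ 7062 ∷ 7082 ∷ 7159 ∷
  7179 ∷ 7183 ∷ 7284 ∷ 7288 ∷ 7308 ∷ 7312 ∷ 7332 ∷ 7433 ∷ 7457 ∷ 7534 ∷ 7538 ∷ 7558 ∷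
  7659 ∷ 7663 ∷ 7687 ∷ 7784 ∷ 7788 ∷ 7808 ∷ 7812 ∷ 7909 ∷ 7913 ∷ 7933 ∷ 7937 ∷ 8038 ∷
  8062 ∷ 8163 ∷ 8183 ∷ 8187 ∷ 8284 ∷ 8304 ∷ 8308 ∷ 8409 ∷ 8413 ∷ 8433 ∷ 8437 ∷ 8534 ∷
  8558 ∷ 8582 ∷ 8659 ∷ 8663 ∷ 8683 ∷ 8764 ∷ 8784 ∷ 8788 ∷ 8812 ∷ 8909 ∷ 8913 ∷ 8933 ∷
  8937 ∷ 9038 ∷ 9058 ∷ 9062 ∷ 9163 ∷ 9167 ∷ 9187 ∷ 9191 ∷ 9288 ∷ 9312 ∷ 9409 ∷ 9413 ∷
  9433 ∷ 9437 ∷ 9538 ∷ 9558 ∷ 9562 ∷ 9663 ∷ 9683 ∷ 9687 ∷ 9707 ∷ 9784 ∷ 9788 ∷ 9808 ∷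
  9889 ∷ 9893 ∷ 9913 ∷ 9917 ∷ 9937 ∷ 10038 ∷ 10058 ∷ 10062 ∷ 10159 ∷ 10163 ∷ 10183 ∷ 10187 ∷
  10268 ∷ 10288 ∷ 10292 ∷ 10312 ∷ 10413 ∷ 10433 ∷ 10437 ∷ 10534 ∷ 10538 ∷ 10558 ∷ 10639 ∷ 10659 ∷
  10663 ∷ 10683 ∷ 10687 ∷ 10784 ∷ 10788 ∷ 10808 ∷ 10812 ∷ 10832 ∷ 10889 ∷ 10909 ∷ 10913 ∷ 10933 ∷
  11014 ∷ 11018 ∷ 11038 ∷ 11062 ∷ 11159 ∷ 11163 ∷ 11183 ∷ 11187 ∷ 11288 ∷ 11312 ∷ 11393 ∷ 11413 ∷
  11417 ∷ 11437 ∷ 11441 ∷ 11538 ∷ 11542 ∷ 11562 ∷ 11659 ∷ 11663 ∷ 11683 ∷ 11687 ∷ 11764 ∷ 11788 ∷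
  11812 ∷ 11913 ∷ 11933 ∷ 11937 ∷ 12014 ∷ 12034 ∷ 12038 ∷ 12139 ∷ 12143 ∷ 12163 ∷ 12167 ∷ 12288 ∷
  12312 ∷ 12437 ∷ 12441 ∷ 12461 ∷ 12542 ∷ 12562 ∷ 12566 ∷ 12586 ∷ 12590 ∷ 12687 ∷ 12691 ∷ 12711 ∷
  12715 ∷ 12788 ∷ 12808 ∷ 12812 ∷ 12832 ∷ 12836 ∷ 12913 ∷ 12937 ∷ 12941 ∷ 12961 ∷ 13062 ∷ 13082 ∷
  13086 ∷ 13163 ∷ 13187 ∷ 13288 ∷ 13292 ∷ 13312 ∷ 13316 ∷ 13437 ∷ 13441 ∷ 13461 ∷ 13538 ∷ 13562 ∷
  13586 ∷ 13667 ∷ 13687 ∷ 13691 ∷ 13711 ∷ 13812 ∷ 13816 ∷ 13836 ∷ 13913 ∷ 13933 ∷ 13937 ∷ 13957 ∷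
  14038 ∷ 14062 ∷ 14086 ∷ 14183 ∷ 14187 ∷ 14207 ∷ 14211 ∷ 14288 ∷ 14308 ∷ 14312 ∷ 14413 ∷ 14417 ∷
  14437 ∷ 14441 ∷ 14538 ∷ 14562 ∷ 14586 ∷ 14663 ∷ 14667 ∷ 14687 ∷ 14691 ∷ 14711 ∷ 14792 ∷ 14812 ∷
  14816 ∷ 14840 ∷ 14917 ∷ 14937 ∷ 14941 ∷ 14961 ∷ 14965 ∷ 15038 ∷ 15058 ∷ 15062 ∷ 15082 ∷ 15086 ∷
  15163 ∷ 15167 ∷ 15187 ∷ 15191 ∷ 15211 ∷ 15288 ∷ 15312 ∷ 15332 ∷ 15336 ∷ 15413 ∷ 15417 ∷ 15437 ∷
  15518 ∷ 15538 ∷ 15542 ∷ 15562 ∷ 15566 ∷ 15663 ∷ 15667 ∷ 15687 ∷ 15691 ∷ 15808 ∷ 15812 ∷ 15832 ∷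
  15836 ∷ 15937 ∷ 15941 ∷ 15961 ∷ 16062 ∷ 16082 ∷ 16086 ∷ 16183 ∷ 16207 ∷ 16288 ∷ 16308 ∷ 16312 ∷
  16332 ∷ 16336 ∷ 16433 ∷ 16457 ∷ 16461 ∷ 16481 ∷ 16538 ∷ 16558 ∷ 16562 ∷ 16582 ∷ 16663 ∷ 16687 ∷
  16711 ∷ 16808 ∷ 16812 ∷ 16832 ∷ 16836 ∷ 16913 ∷ 16933 ∷ 16937 ∷ 16957 ∷ 17038 ∷ 17062 ∷ 17086 ∷
  17187 ∷ 17207 ∷ 17211 ∷ 17284 ∷ 17308 ∷ 17328 ∷ 17332 ∷ 17413 ∷ 17433 ∷ 17437 ∷ 17457 ∷ 17461 ∷
  17558 ∷ 17582 ∷ 17606 ∷ 17659 ∷ 17663 ∷ 17683 ∷ 17687 ∷ 17707 ∷ 17788 ∷ 17808 ∷ 17812 ∷ 17933 ∷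
  17937 ∷ 17957 ∷ 18038 ∷ 18058 ∷ 18062 ∷ 18082 ∷ 18086 ∷ 18163 ∷ 18167 ∷ 18187 ∷ 18191 ∷ 18211 ∷
  18312 ∷ 18332 ∷ 18336 ∷ 18409 ∷ 18433 ∷ 18437 ∷ 18457 ∷ 18538 ∷ 18558 ∷ 18562 ∷ 18582 ∷ 18586 ∷
  18683 ∷ 18687 ∷ 18707 ∷ 18711 ∷ 18784 ∷ 18788 ∷ 18808 ∷ 18812 ∷ 18913 ∷ 18917 ∷ 18937 ∷ 19038 ∷
  19058 ∷ 19062 ∷ 19086 ∷ 19163 ∷ 19183 ∷ 19187 ∷ 19207 ∷ 19288 ∷ 19312 ∷ 19336 ∷ 19433 ∷ 19437 ∷
  19457 ∷ 19461 ∷ 19534 ∷ 19558 ∷ 19582 ∷ 19659 ∷ 19663 ∷ 19683 ∷ 19687 ∷ 19707 ∷ 19808 ∷ 19832 ∷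
  19909 ∷ 19913 ∷ 19933 ∷ 20038 ∷ 20062 ∷ 20163 ∷ 20183 ∷ 20187 ∷ 20288 ∷ 20308 ∷ 20312 ∷ 20413 ∷
  20417 ∷ 20437 ∷ 20538 ∷ 20558 ∷ 20562 ∷ 20586 ∷ 20659 ∷ 20683 ∷ 20707 ∷ 20784 ∷ 20788 ∷ 20808 ∷
  20812 ∷ 20933 ∷ 20937 ∷ 20957 ∷ 21034 ∷ 21038 ∷ 21058 ∷ 21139 ∷ 21163 ∷ 21187 ∷ 21288 ∷ 21308 ∷
  21312 ∷ 21413 ∷ 21437 ∷ 21538 ∷ 21542 ∷ 21562 ∷ 21566 ∷ 21687 ∷ 21691 ∷ 21711 ∷ 21784 ∷ 21788 ∷
  21808 ∷ 21812 ∷ 21832 ∷ 21913 ∷ 21937 ∷ 21961 ∷ 22038 ∷ 22058 ∷ 22062 ∷ 22082 ∷ 22086 ∷ 22163 ∷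
  22183 ∷ 22187 ∷ 22268 ∷ 22288 ∷ 22292 ∷ 22312 ∷ 22413 ∷ 22437 ∷ 22538 ∷ 22558 ∷ 22562 ∷ 22643 ∷
  22663 ∷ 22667 ∷ 22687 ∷ 22691 ∷ 22788 ∷ 22812 ∷ 22836 ∷ 22909 ∷ 22913 ∷ 22933 ∷ 22937 ∷ 22957 ∷
  23014 ∷ 23038 ∷ 23058 ∷ 23062 ∷ 23163 ∷ 23183 ∷ 23187 ∷ 23207 ∷ 23264 ∷ 23284 ∷ 23288 ∷ 23308 ∷
  23389 ∷ 23393 ∷ 23413 ∷ 23417 ∷ 23437 ∷ 23538 ∷ 23558 ∷ 23562 ∷ 23663 ∷ 23667 ∷ 23687 ∷ 23768 ∷
  23788 ∷ 23792 ∷ 23812 ∷ 23816 ∷ 23917 ∷ 23937 ∷ 23941 ∷ 24034 ∷ 24038 ∷ 24058 ∷ 24062 ∷ 24163 ∷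
  24167 ∷ 24187 ∷ 24288 ∷ 24308 ∷ 24312 ∷ 24336 ∷ 24389 ∷ 24413 ∷ 24437 ∷ 24518 ∷ 24538 ∷ 24542 ∷
  24663 ∷ 24667 ∷ 24687 ∷ 24812 ∷ 24832 ∷ 24836 ∷ 24917 ∷ 24937 ∷ 24941 ∷ 24961 ∷ 24965 ∷ 25062 ∷
  25086 ∷ 25183 ∷ 25187 ∷ 25207 ∷ 25211 ∷ 25288 ∷ 25312 ∷ 25332 ∷ 25336 ∷ 25433 ∷ 25437 ∷ 25457 ∷
  25461 ∷ 25481 ∷ 25538 ∷ 25558 ∷ 25562 ∷ 25582 ∷ 25663 ∷ 25667 ∷ 25687 ∷ 25691 ∷ 25711 ∷ 25812 ∷
  25832 ∷ 25836 ∷ 25913 ∷ 25933 ∷ 25937 ∷ 25957 ∷ 25961 ∷ 26038 ∷ 26042 ∷ 26062 ∷ 26066 ∷ 26086 ∷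
  26187 ∷ 26207 ∷ 26211 ∷ 26284 ∷ 26308 ∷ 26312 ∷ 26332 ∷ 26413 ∷ 26433 ∷ 26437 ∷ 26457 ∷ 26461 ∷
  26558 ∷ 26562 ∷ 26582 ∷ 26586 ∷ 26606 ∷ 26659 ∷ 26663 ∷ 26683 ∷ 26687 ∷ 26707 ∷ 26788 ∷ 26792 ∷
  26812 ∷ 26836 ∷ 26933 ∷ 26937 ∷ 26957 ∷ 26961 ∷ 27038 ∷ 27062 ∷ 27086 ∷ 27163 ∷ 27167 ∷ 27187 ∷
  27191 ∷ 27211 ∷ 27215 ∷ 27312 ∷ 27316 ∷ 27336 ∷ 27409 ∷ 27413 ∷ 27433 ∷ 27437 ∷ 27457 ∷ 27461 ∷
  27538 ∷ 27562 ∷ 27586 ∷ 27683 ∷ 27687 ∷ 27707 ∷ 27711 ∷ 27788 ∷ 27808 ∷ 27812 ∷ 27913 ∷ 27917 ∷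
  27937 ∷ 27941 ∷ 28038 ∷ 28062 ∷ 28086 ∷ 28183 ∷ 28187 ∷ 28207 ∷ 28211 ∷ 28312 ∷ 28332 ∷ 28336 ∷
  28437 ∷ 28457 ∷ 28461 ∷ 28481 ∷ 28558 ∷ 28578 ∷ 28582 ∷ 28602 ∷ 28683 ∷ 28687 ∷ 28707 ∷ 28711 ∷
  28731 ∷ 28808 ∷ 28832 ∷ 28852 ∷ 28856 ∷ 28933 ∷ 28937 ∷ 28957 ∷ 29038 ∷ 29058 ∷ 29062 ∷ 29082 ∷
  29086 ∷ 29183 ∷ 29187 ∷ 29207 ∷ 29211 ∷ 29308 ∷ 29312 ∷ 29332 ∷ 29413 ∷ 29433 ∷ 29437 ∷ 29457 ∷
  29461 ∷ 29558 ∷ 29562 ∷ 29582 ∷ 29586 ∷ 29606 ∷ 29679 ∷ 29683 ∷ 29703 ∷ 29707 ∷ 29727 ∷ 29784 ∷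
  29808 ∷ 29812 ∷ 29832 ∷ 29856 ∷ 29933 ∷ 29953 ∷ 29957 ∷ 29977 ∷ 29981 ∷ 30034 ∷ 30058 ∷ 30082 ∷
  30159 ∷ 30163 ∷ 30183 ∷ 30187 ∷ 30207 ∷ 30308 ∷ 30312 ∷ 30332 ∷ 30413 ∷ 30433 ∷ 30437 ∷ 30457 ∷
  30461 ∷ 30538 ∷ 30562 ∷ 30586 ∷ 30683 ∷ 30687 ∷ 30707 ∷ 30711 ∷ 30784 ∷ 30808 ∷ 30828 ∷ 30832 ∷
  30909 ∷ 30913 ∷ 30933 ∷ 30937 ∷ 30957 ∷ 30961 ∷ 31058 ∷ 31082 ∷ 31106 ∷ 31159 ∷ 31163 ∷ 31183 ∷
  31187 ∷ 31207 ∷ 31288 ∷ 31308 ∷ 31312 ∷ 31336 ∷ 31433 ∷ 31437 ∷ 31457 ∷ 31461 ∷ 31534 ∷ 31558 ∷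
  31562 ∷ 31582 ∷ 31663 ∷ 31683 ∷ 31687 ∷ 31711 ∷ 31808 ∷ 31812 ∷ 31832 ∷ 31836 ∷ 31909 ∷ 31929 ∷
  31933 ∷ 31953 ∷ 31957 ∷ 32034 ∷ 32058 ∷ 32062 ∷ 32082 ∷ 32183 ∷ 32203 ∷ 32207 ∷ 32284 ∷ 32308 ∷
  32409 ∷ 32413 ∷ 32433 ∷ 32437 ∷ 32558 ∷ 32562 ∷ 32582 ∷ 32659 ∷ 32663 ∷ 32683 ∷ 32687 ∷ 32707 ∷
  32788 ∷ 32808 ∷ 32812 ∷ 32836 ∷ 32933 ∷ 32937 ∷ 32957 ∷ 32961 ∷ 33034 ∷ 33054 ∷ 33058 ∷ 33078 ∷
  33082 ∷ 33159 ∷ 33163 ∷ 33183 ∷ 33187 ∷ 33207 ∷ 33308 ∷ 33328 ∷ 33332 ∷ 33409 ∷ 33413 ∷ 33433 ∷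
  33534 ∷ 33538 ∷ 33558 ∷ 33562 ∷ 33659 ∷ 33683 ∷ 33687 ∷ 33788 ∷ 33808 ∷ 33812 ∷ 33832 ∷ 33913 ∷
  33917 ∷ 33937 ∷ 33941 ∷ 33961 ∷ 34062 ∷ 34082 ∷ 34086 ∷ 34159 ∷ 34183 ∷ 34187 ∷ 34207 ∷ 34288 ∷
  34308 ∷ 34312 ∷ 34332 ∷ 34336 ∷ 34433 ∷ 34437 ∷ 34457 ∷ 34461 ∷ 34534 ∷ 34538 ∷ 34558 ∷ 34562 ∷
  34663 ∷ 34667 ∷ 34687 ∷ 34788 ∷ 34808 ∷ 34812 ∷ 34909 ∷ 34913 ∷ 34933 ∷ 34937 ∷ 34957 ∷ 35038 ∷
  35042 ∷ 35062 ∷ 35086 ∷ 35163 ∷ 35183 ∷ 35187 ∷ 35207 ∷ 35211 ∷ 35284 ∷ 35308 ∷ 35332 ∷ 35409 ∷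
  35413 ∷ 35433 ∷ 35437 ∷ 35457 ∷ 35534 ∷ 35558 ∷ 35562 ∷ 35582 ∷ 35659 ∷ 35663 ∷ 35683 ∷ 35764 ∷
  35788 ∷ 35812 ∷ 35909 ∷ 35913 ∷ 35933 ∷ 35937 ∷ 36038 ∷ 36058 ∷ 36062 ∷ 36163 ∷ 36167 ∷ 36187 ∷
  36191 ∷ 36288 ∷ 36312 ∷ 36336 ∷ 36409 ∷ 36413 ∷ 36433 ∷ 36437 ∷ 36457 ∷ 36538 ∷ 36558 ∷ 36562 ∷
  36586 ∷ 36683 ∷ 36687 ∷ 36707 ∷ 36711 ∷ 36784 ∷ 36788 ∷ 36808 ∷ 36812 ∷ 36889 ∷ 36913 ∷ 36917 ∷
  36937 ∷ 37038 ∷ 37058 ∷ 37062 ∷ 37167 ∷ 37187 ∷ 37191 ∷ 37292 ∷ 37296 ∷ 37316 ∷ 37437 ∷ 37441 ∷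
  37461 ∷ 37465 ∷ 37538 ∷ 37562 ∷ 37586 ∷ 37663 ∷ 37667 ∷ 37687 ∷ 37691 ∷ 37711 ∷ 37812 ∷ 37816 ∷
  37836 ∷ 37913 ∷ 37917 ∷ 37937 ∷ 38042 ∷ 38066 ∷ 38167 ∷ 38187 ∷ 38191 ∷ 38288 ∷ 38292 ∷ 38312 ∷
  38316 ∷ 38417 ∷ 38441 ∷ 38542 ∷ 38562 ∷ 38566 ∷ 38586 ∷ 38663 ∷ 38683 ∷ 38687 ∷ 38788 ∷ 38792 ∷
  38812 ∷ 38816 ∷ 38836 ∷ 38913 ∷ 38937 ∷ 38961 ∷ 39038 ∷ 39042 ∷ 39062 ∷ 39143 ∷ 39163 ∷ 39167 ∷
  39191 ∷ 39288 ∷ 39292 ∷ 39312 ∷ 39316 ∷ 39413 ∷ 39417 ∷ 39437 ∷ 39441 ∷ 39522 ∷ 39542 ∷ 39546 ∷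
  39566 ∷ 39667 ∷ 39687 ∷ 39691 ∷ 39788 ∷ 39792 ∷ 39812 ∷ 39893 ∷ 39913 ∷ 39917 ∷ 39937 ∷ 39941 ∷
  40038 ∷ 40042 ∷ 40062 ∷ 40066 ∷ 40086 ∷ 40143 ∷ 40163 ∷ 40167 ∷ 40187 ∷ 40268 ∷ 40272 ∷ 40292 ∷
  40316 ∷ 40413 ∷ 40417 ∷ 40437 ∷ 40441 ∷ 40538 ∷ 40562 ∷ 40586 ∷ 40667 ∷ 40687 ∷ 40691 ∷ 40711 ∷
  40812 ∷ 40816 ∷ 40836 ∷ 40913 ∷ 40933 ∷ 40937 ∷ 40957 ∷ 41038 ∷ 41062 ∷ 41086 ∷ 41183 ∷ 41187 ∷
  41207 ∷ 41211 ∷ 41288 ∷ 41308 ∷ 41312 ∷ 41413 ∷ 41417 ∷ 41437 ∷ 41441 ∷ 41562 ∷ 41663 ∷ 41683 ∷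
  41687 ∷ 41788 ∷ 41792 ∷ 41812 ∷ 41816 ∷ 41836 ∷ 41937 ∷ 41961 ∷ 42034 ∷ 42038 ∷ 42058 ∷ 42062 ∷
  42082 ∷ 42163 ∷ 42183 ∷ 42187 ∷ 42211 ∷ 42308 ∷ 42312 ∷ 42332 ∷ 42336 ∷ 42409 ∷ 42413 ∷ 42433 ∷
  42437 ∷ 42538 ∷ 42542 ∷ 42562 ∷ 42663 ∷ 42683 ∷ 42687 ∷ 42788 ∷ 42792 ∷ 42812 ∷ 42913 ∷ 42917 ∷
  42937 ∷ 42941 ∷ 43042 ∷ 43062 ∷ 43066 ∷ 43086 ∷ 43159 ∷ 43163 ∷ 43183 ∷ 43187 ∷ 43207 ∷ 43288 ∷
  43292 ∷ 43312 ∷ 43336 ∷ 43413 ∷ 43433 ∷ 43437 ∷ 43457 ∷ 43461 ∷ 43538 ∷ 43562 ∷ 43643 ∷ 43663 ∷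
  43667 ∷ 43687 ∷ 43691 ∷ 43788 ∷ 43792 ∷ 43812 ∷ 43913 ∷ 43937 ∷ 44038 ∷ 44042 ∷ 44062 ∷ 44066 ∷
  44163 ∷ 44187 ∷ 44284 ∷ 44288 ∷ 44308 ∷ 44312 ∷ 44413 ∷ 44437 ∷ 44538 ∷ 44558 ∷ 44562 ∷ 44582 ∷
  44659 ∷ 44663 ∷ 44764 ∷ 44768 ∷ 44788 ∷ 44792 ∷ 44812 ∷ 44913 ∷ 44937 ∷ 45038 ∷ 45062 ∷ 45143 ∷
  45163 ∷ 45167 ∷ 45187 ∷ 45191 ∷ 45288 ∷ 45292 ∷ 45312 ∷ 45409 ∷ 45413 ∷ 45433 ∷ 45437 ∷ 45514 ∷
  45538 ∷ 45562 ∷ 45663 ∷ 45683 ∷ 45687 ∷ 45764 ∷ 45784 ∷ 45788 ∷ 45889 ∷ 45893 ∷ 45913 ∷ 45917 ∷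
  46038 ∷ 46062 ∷ 46163 ∷ 46167 ∷ 46187 ∷ 46268 ∷ 46292 ∷ 46316 ∷ 46417 ∷ 46437 ∷ 46441 ∷ 46538 ∷
  46558 ∷ 46562 ∷ 46643 ∷ 46663 ∷ 46667 ∷ 46687 ∷ 46691 ∷ 46788 ∷ 46812 ∷ 46889 ∷ 46893 ∷ 46913 ∷
  46917 ∷ 47018 ∷ 47038 ∷ 47042 ∷ 47163 ∷ 47167 ∷ 47187 ∷ 47268 ∷ 47288 ∷ 47292 ∷ 47312 ∷ 47393 ∷
  47413 ∷ 47417 ∷ 47441 ∷ 47538 ∷ 47542 ∷ 47562 ∷ 47566 ∷ 47639 ∷ 47659 ∷ 47663 ∷ 47683 ∷ 47687 ∷
  47764 ∷ 47768 ∷ 47788 ∷ 47792 ∷ 47812 ∷ 47913 ∷ 47933 ∷ 47937 ∷ 48014 ∷ 48018 ∷ 48038 ∷ 48139 ∷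
  48143 ∷ 48163 ∷ 48167 ∷ 48288 ∷ 48292 ∷ 48312 ∷ 48393 ∷ 48413 ∷ 48417 ∷ 48437 ∷ 48518 ∷ 48522 ∷
  48542 ∷ 48566 ∷ 48667 ∷ 48687 ∷ 48691 ∷ 48764 ∷ 48788 ∷ 48812 ∷ 48893 ∷ 48913 ∷ 48917 ∷ 48937 ∷
  48941 ∷ 49038 ∷ 49042 ∷ 49062 ∷ 49139 ∷ 49143 ∷ 49163 ∷ 49167 ∷ 49268 ∷ 49292 ∷ 49413 ∷ 49417 ∷
  49542 ∷ 49562 ∷ 49566 ∷ 49586 ∷ 49667 ∷ 49671 ∷ 49691 ∷ 49695 ∷ 49715 ∷ 49816 ∷ 49836 ∷ 49840 ∷
  49913 ∷ 49937 ∷ 49941 ∷ 49961 ∷ 50042 ∷ 50062 ∷ 50066 ∷ 50086 ∷ 50090 ∷ 50187 ∷ 50191 ∷ 50211 ∷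
  50215 ∷ 50288 ∷ 50292 ∷ 50312 ∷ 50316 ∷ 50417 ∷ 50421 ∷ 50441 ∷ 50542 ∷ 50562 ∷ 50566 ∷ 50667 ∷
  50687 ∷ 50691 ∷ 50711 ∷ 50792 ∷ 50796 ∷ 50816 ∷ 50840 ∷ 50917 ∷ 50937 ∷ 50941 ∷ 50961 ∷ 50965 ∷
  51038 ∷ 51062 ∷ 51086 ∷ 51163 ∷ 51167 ∷ 51187 ∷ 51191 ∷ 51211 ∷ 51312 ∷ 51316 ∷ 51336 ∷ 51413 ∷
  51417 ∷ 51437 ∷ 51518 ∷ 51542 ∷ 51566 ∷ 51667 ∷ 51687 ∷ 51691 ∷ 51792 ∷ 51812 ∷ 51816 ∷ 51897 ∷
  51917 ∷ 51921 ∷ 51941 ∷ 51945 ∷ 52042 ∷ 52066 ∷ 52090 ∷ 52163 ∷ 52167 ∷ 52187 ∷ 52191 ∷ 52211 ∷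
  52268 ∷ 52292 ∷ 52312 ∷ 52316 ∷ 52340 ∷ 52417 ∷ 52437 ∷ 52441 ∷ 52461 ∷ 52465 ∷ 52518 ∷ 52538 ∷
  52542 ∷ 52562 ∷ 52566 ∷ 52643 ∷ 52647 ∷ 52667 ∷ 52671 ∷ 52691 ∷ 52792 ∷ 52812 ∷ 52816 ∷ 52937 ∷
  52941 ∷ 52961 ∷ 53042 ∷ 53062 ∷ 53066 ∷ 53086 ∷ 53090 ∷ 53187 ∷ 53191 ∷ 53211 ∷ 53215 ∷ 53288 ∷
  53308 ∷ 53312 ∷ 53332 ∷ 53336 ∷ 53413 ∷ 53437 ∷ 53441 ∷ 53461 ∷ 53562 ∷ 53582 ∷ 53586 ∷ 53663 ∷
  53687 ∷ 53788 ∷ 53792 ∷ 53812 ∷ 53816 ∷ 53937 ∷ 53941 ∷ 53961 ∷ 54038 ∷ 54062 ∷ 54086 ∷ 54167 ∷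
  54187 ∷ 54191 ∷ 54211 ∷ 54312 ∷ 54316 ∷ 54336 ∷ 54413 ∷ 54433 ∷ 54437 ∷ 54457 ∷ 54538 ∷ 54562 ∷
  54586 ∷ 54683 ∷ 54687 ∷ 54707 ∷ 54711 ∷ 54788 ∷ 54808 ∷ 54812 ∷ 54913 ∷ 54917 ∷ 54937 ∷ 54941 ∷
  55038 ∷ 55062 ∷ 55086 ∷ 55163 ∷ 55167 ∷ 55187 ∷ 55191 ∷ 55211 ∷ 55292 ∷ 55312 ∷ 55316 ∷ 55340 ∷
  55417 ∷ 55437 ∷ 55441 ∷ 55461 ∷ 55465 ∷ 55538 ∷ 55558 ∷ 55562 ∷ 55582 ∷ 55586 ∷ 55663 ∷ 55667 ∷
  55687 ∷ 55691 ∷ 55711 ∷ 55788 ∷ 55812 ∷ 55832 ∷ 55836 ∷ 55913 ∷ 55917 ∷ 55937 ∷ 56018 ∷ 56038 ∷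
  56042 ∷ 56062 ∷ 56066 ∷ 56163 ∷ 56167 ∷ 56187 ∷ 56191 ∷ 56288 ∷ 56312 ∷ 56413 ∷ 56417 ∷ 56437 ∷
  56441 ∷ 56562 ∷ 56566 ∷ 56586 ∷ 56659 ∷ 56663 ∷ 56683 ∷ 56687 ∷ 56707 ∷ 56788 ∷ 56812 ∷ 56836 ∷
  56913 ∷ 56933 ∷ 56937 ∷ 56957 ∷ 56961 ∷ 57038 ∷ 57062 ∷ 57143 ∷ 57163 ∷ 57167 ∷ 57187 ∷ 57288 ∷
  57312 ∷ 57413 ∷ 57417 ∷ 57437 ∷ 57518 ∷ 57538 ∷ 57542 ∷ 57562 ∷ 57566 ∷ 57667 ∷ 57687 ∷ 57691 ∷
  57784 ∷ 57788 ∷ 57808 ∷ 57812 ∷ 57913 ∷ 57917 ∷ 57937 ∷ 58038 ∷ 58058 ∷ 58062 ∷ 58086 ∷ 58139 ∷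
  58163 ∷ 58187 ∷ 58268 ∷ 58288 ∷ 58292 ∷ 58413 ∷ 58417 ∷ 58437 ∷ 58538 ∷ 58542 ∷ 58562 ∷ 58566 ∷
  58667 ∷ 58671 ∷ 58691 ∷ 58792 ∷ 58812 ∷ 58816 ∷ 58913 ∷ 58937 ∷ 59018 ∷ 59038 ∷ 59042 ∷ 59062 ∷
  59066 ∷ 59163 ∷ 59187 ∷ 59191 ∷ 59211 ∷ 59268 ∷ 59288 ∷ 59292 ∷ 59312 ∷ 59393 ∷ 59417 ∷ 59441 ∷
  59538 ∷ 59542 ∷ 59562 ∷ 59566 ∷ 59643 ∷ 59663 ∷ 59667 ∷ 59687 ∷ 59768 ∷ 59792 ∷ 59816 ∷ 59917 ∷
  59937 ∷ 59941 ∷ 60014 ∷ 60038 ∷ 60058 ∷ 60062 ∷ 60143 ∷ 60163 ∷ 60167 ∷ 60187 ∷ 60191 ∷ 60288 ∷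
  60312 ∷ 60336 ∷ 60389 ∷ 60393 ∷ 60413 ∷ 60417 ∷ 60437 ∷ 60518 ∷ 60538 ∷ 60542 ∷ 60663 ∷ 60667 ∷
  60687 ∷ 60768 ∷ 60788 ∷ 60792 ∷ 60812 ∷ 60816 ∷ 60897 ∷ 60917 ∷ 60921 ∷ 60941 ∷ 61042 ∷ 61062 ∷
  61066 ∷ 61163 ∷ 61167 ∷ 61187 ∷ 61268 ∷ 61288 ∷ 61292 ∷ 61312 ∷ 61316 ∷ 61413 ∷ 61417 ∷ 61437 ∷
  61441 ∷ 61518 ∷ 61538 ∷ 61542 ∷ 61643 ∷ 61647 ∷ 61667 ∷ 61788 ∷ 61792 ∷ 61816 ∷ 61917 ∷ 61937 ∷
  61941 ∷ 61961 ∷ 62042 ∷ 62066 ∷ 62090 ∷ 62187 ∷ 62191 ∷ 62211 ∷ 62215 ∷ 62288 ∷ 62312 ∷ 62332 ∷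
  62336 ∷ 62413 ∷ 62417 ∷ 62437 ∷ 62441 ∷ 62461 ∷ 62465 ∷ 62562 ∷ 62586 ∷ 62663 ∷ 62667 ∷ 62687 ∷
  62691 ∷ 62792 ∷ 62812 ∷ 62816 ∷ 62937 ∷ 62941 ∷ 62961 ∷ 63038 ∷ 63042 ∷ 63062 ∷ 63066 ∷ 63086 ∷
  63167 ∷ 63187 ∷ 63191 ∷ 63215 ∷ 63312 ∷ 63316 ∷ 63336 ∷ 63340 ∷ 63413 ∷ 63433 ∷ 63437 ∷ 63457 ∷
  63461 ∷ 63538 ∷ 63542 ∷ 63562 ∷ 63566 ∷ 63586 ∷ 63687 ∷ 63707 ∷ 63711 ∷ 63788 ∷ 63792 ∷ 63812 ∷
  63913 ∷ 63917 ∷ 63937 ∷ 63941 ∷ 64038 ∷ 64062 ∷ 64066 ∷ 64086 ∷ 64163 ∷ 64167 ∷ 64187 ∷ 64191 ∷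
  64211 ∷ 64292 ∷ 64296 ∷ 64316 ∷ 64340 ∷ 64417 ∷ 64437 ∷ 64441 ∷ 64461 ∷ 64465 ∷ 64538 ∷ 64562 ∷
  64586 ∷ 64663 ∷ 64667 ∷ 64687 ∷ 64691 ∷ 64711 ∷ 64715 ∷ 64788 ∷ 64812 ∷ 64816 ∷ 64836 ∷ 64913 ∷
  64917 ∷ 64937 ∷ 64941 ∷ 65018 ∷ 65042 ∷ 65066 ∷ 65163 ∷ 65167 ∷ 65187 ∷ 65191 ∷ 65312 ∷ 65332 ∷
  65336 ∷ 65417 ∷ 65437 ∷ 65441 ∷ 65461 ∷ 65465 ∷ 65562 ∷ 65586 ∷ 65683 ∷ 65687 ∷ 65707 ∷ 65711 ∷
  65788 ∷ 65812 ∷ 65832 ∷ 65836 ∷ 65933 ∷ 65937 ∷ 65957 ∷ 65961 ∷ 65981 ∷ 66038 ∷ 66058 ∷ 66062 ∷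
  66082 ∷ 66163 ∷ 66167 ∷ 66187 ∷ 66191 ∷ 66211 ∷ 66312 ∷ 66332 ∷ 66336 ∷ 66413 ∷ 66433 ∷ 66437 ∷
  66457 ∷ 66461 ∷ 66538 ∷ 66542 ∷ 66562 ∷ 66566 ∷ 66586 ∷ 66687 ∷ 66707 ∷ 66711 ∷ 66784 ∷ 66808 ∷
  66812 ∷ 66832 ∷ 66913 ∷ 66933 ∷ 66937 ∷ 66957 ∷ 66961 ∷ 67058 ∷ 67062 ∷ 67082 ∷ 67086 ∷ 67106 ∷
  67159 ∷ 67163 ∷ 67183 ∷ 67187 ∷ 67207 ∷ 67288 ∷ 67292 ∷ 67312 ∷ 67336 ∷ 67433 ∷ 67437 ∷ 67457 ∷
  67461 ∷ 67538 ∷ 67562 ∷ 67586 ∷ 67663 ∷ 67667 ∷ 67687 ∷ 67691 ∷ 67711 ∷ 67715 ∷ 67812 ∷ 67816 ∷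
  67836 ∷ 67909 ∷ 67913 ∷ 67933 ∷ 67937 ∷ 67957 ∷ 67961 ∷ 68038 ∷ 68062 ∷ 68086 ∷ 68183 ∷ 68187 ∷
  68207 ∷ 68211 ∷ 68288 ∷ 68308 ∷ 68312 ∷ 68413 ∷ 68417 ∷ 68437 ∷ 68441 ∷ 68538 ∷ 68562 ∷ 68586 ∷
  68663 ∷ 68683 ∷ 68687 ∷ 68788 ∷ 68792 ∷ 68812 ∷ 68816 ∷ 68836 ∷ 68937 ∷ 68961 ∷ 69034 ∷ 69058 ∷
  69062 ∷ 69082 ∷ 69163 ∷ 69183 ∷ 69187 ∷ 69211 ∷ 69308 ∷ 69312 ∷ 69332 ∷ 69336 ∷ 69409 ∷ 69413 ∷
  69433 ∷ 69437 ∷ 69538 ∷ 69542 ∷ 69562 ∷ 69663 ∷ 69683 ∷ 69687 ∷ 69788 ∷ 69808 ∷ 69812 ∷ 69913 ∷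
  69917 ∷ 69937 ∷ 69941 ∷ 70038 ∷ 70062 ∷ 70086 ∷ 70159 ∷ 70163 ∷ 70183 ∷ 70187 ∷ 70207 ∷ 70288 ∷
  70308 ∷ 70312 ∷ 70336 ∷ 70433 ∷ 70437 ∷ 70457 ∷ 70461 ∷ 70534 ∷ 70538 ∷ 70558 ∷ 70562 ∷ 70639 ∷
  70663 ∷ 70667 ∷ 70687 ∷ 70788 ∷ 70808 ∷ 70812 ∷ 70913 ∷ 70917 ∷ 70937 ∷ 70941 ∷ 71042 ∷ 71062 ∷
  71066 ∷ 71167 ∷ 71187 ∷ 71191 ∷ 71211 ∷ 71288 ∷ 71308 ∷ 71312 ∷ 71332 ∷ 71413 ∷ 71417 ∷ 71437 ∷
  71441 ∷ 71461 ∷ 71538 ∷ 71562 ∷ 71582 ∷ 71586 ∷ 71663 ∷ 71667 ∷ 71687 ∷ 71768 ∷ 71788 ∷ 71792 ∷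
  71812 ∷ 71816 ∷ 71913 ∷ 71917 ∷ 71937 ∷ 71941 ∷ 72038 ∷ 72042 ∷ 72062 ∷ 72143 ∷ 72163 ∷ 72167 ∷
  72187 ∷ 72191 ∷ 72288 ∷ 72292 ∷ 72312 ∷ 72316 ∷ 72336 ∷ 72409 ∷ 72413 ∷ 72433 ∷ 72437 ∷ 72457 ∷
  72514 ∷ 72538 ∷ 72542 ∷ 72562 ∷ 72586 ∷ 72663 ∷ 72683 ∷ 72687 ∷ 72707 ∷ 72711 ∷ 72764 ∷ 72788 ∷
  72812 ∷ 72889 ∷ 72893 ∷ 72913 ∷ 72917 ∷ 72937 ∷ 73038 ∷ 73042 ∷ 73062 ∷ 73163 ∷ 73167 ∷ 73187 ∷
  73191 ∷ 73268 ∷ 73292 ∷ 73316 ∷ 73417 ∷ 73437 ∷ 73441 ∷ 73538 ∷ 73558 ∷ 73562 ∷ 73663 ∷ 73667 ∷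
  73687 ∷ 73691 ∷ 73788 ∷ 73812 ∷ 73836 ∷ 73889 ∷ 73913 ∷ 73917 ∷ 73937 ∷ 74018 ∷ 74038 ∷ 74042 ∷
  74066 ∷ 74163 ∷ 74167 ∷ 74187 ∷ 74191 ∷ 74312 ∷ 74316 ∷ 74336 ∷ 74340 ∷ 74441 ∷ 74445 ∷ 74465 ∷
  74566 ∷ 74586 ∷ 74590 ∷ 74687 ∷ 74711 ∷ 74792 ∷ 74812 ∷ 74816 ∷ 74836 ∷ 74840 ∷ 74937 ∷ 74961 ∷
  74965 ∷ 75042 ∷ 75062 ∷ 75066 ∷ 75167 ∷ 75191 ∷ 75312 ∷ 75316 ∷ 75336 ∷ 75340 ∷ 75417 ∷ 75437 ∷
  75441 ∷ 75461 ∷ 75542 ∷ 75566 ∷ 75590 ∷ 75691 ∷ 75711 ∷ 75715 ∷ 75788 ∷ 75812 ∷ 75836 ∷ 75917 ∷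
  75937 ∷ 75941 ∷ 75961 ∷ 75965 ∷ 76062 ∷ 76086 ∷ 76163 ∷ 76167 ∷ 76187 ∷ 76191 ∷ 76292 ∷ 76316 ∷
  76437 ∷ 76441 ∷ 76461 ∷ 76542 ∷ 76562 ∷ 76566 ∷ 76590 ∷ 76667 ∷ 76671 ∷ 76691 ∷ 76695 ∷ 76715 ∷
  76816 ∷ 76840 ∷ 76913 ∷ 76937 ∷ 76941 ∷ 76961 ∷ 77042 ∷ 77062 ∷ 77066 ∷ 77090 ∷ 77187 ∷ 77191 ∷
  77211 ∷ 77215 ∷ 77288 ∷ 77292 ∷ 77312 ∷ 77316 ∷ 77417 ∷ 77421 ∷ 77441 ∷ 77542 ∷ 77562 ∷ 77566 ∷
  77687 ∷ 77711 ∷ 77812 ∷ 77816 ∷ 77836 ∷ 77840 ∷ 77961 ∷ 77965 ∷ 78058 ∷ 78062 ∷ 78082 ∷ 78086 ∷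
  78187 ∷ 78211 ∷ 78312 ∷ 78332 ∷ 78336 ∷ 78356 ∷ 78360 ∷ 78437 ∷ 78461 ∷ 78542 ∷ 78562 ∷ 78566 ∷
  78586 ∷ 78687 ∷ 78711 ∷ 78812 ∷ 78836 ∷ 78917 ∷ 78937 ∷ 78941 ∷ 78961 ∷ 78965 ∷ 79062 ∷ 79086 ∷
  79183 ∷ 79187 ∷ 79207 ∷ 79211 ∷ 79288 ∷ 79312 ∷ 79336 ∷ 79437 ∷ 79457 ∷ 79461 ∷ 79481 ∷ 79538 ∷
  79558 ∷ 79562 ∷ 79663 ∷ 79667 ∷ 79687 ∷ 79691 ∷ 79711 ∷ 79812 ∷ 79836 ∷ 79937 ∷ 79941 ∷ 79961 ∷
  80042 ∷ 80062 ∷ 80066 ∷ 80090 ∷ 80187 ∷ 80191 ∷ 80211 ∷ 80215 ∷ 80288 ∷ 80308 ∷ 80312 ∷ 80332 ∷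
  80336 ∷ 80413 ∷ 80437 ∷ 80441 ∷ 80461 ∷ 80562 ∷ 80582 ∷ 80586 ∷ 80663 ∷ 80687 ∷ 80788 ∷ 80792 ∷
  80812 ∷ 80816 ∷ 80937 ∷ 80941 ∷ 80961 ∷ 81038 ∷ 81062 ∷ 81086 ∷ 81167 ∷ 81187 ∷ 81191 ∷ 81312 ∷
  81336 ∷ 81433 ∷ 81437 ∷ 81457 ∷ 81538 ∷ 81562 ∷ 81586 ∷ 81683 ∷ 81687 ∷ 81707 ∷ 81711 ∷ 81788 ∷
  81812 ∷ 81913 ∷ 81917 ∷ 81937 ∷ 81941 ∷ 82062 ∷ 82163 ∷ 82187 ∷ 82292 ∷ 82312 ∷ 82316 ∷ 82437 ∷
  82441 ∷ 82461 ∷ 82538 ∷ 82558 ∷ 82562 ∷ 82582 ∷ 82663 ∷ 82687 ∷ 82711 ∷ 82808 ∷ 82812 ∷ 82832 ∷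
  82836 ∷ 82913 ∷ 82937 ∷ 83038 ∷ 83042 ∷ 83062 ∷ 83066 ∷ 83163 ∷ 83187 ∷ 83292 ∷ 83312 ∷ 83316 ∷
  83417 ∷ 83441 ∷ 83562 ∷ 83566 ∷ 83586 ∷ 83590 ∷ 83663 ∷ 83687 ∷ 83711 ∷ 83788 ∷ 83792 ∷ 83812 ∷
  83816 ∷ 83836 ∷ 83937 ∷ 83961 ∷ 84038 ∷ 84042 ∷ 84062 ∷ 84167 ∷ 84191 ∷ 84292 ∷ 84312 ∷ 84316 ∷
  84413 ∷ 84417 ∷ 84437 ∷ 84441 ∷ 84542 ∷ 84566 ∷ 84667 ∷ 84687 ∷ 84691 ∷ 84711 ∷ 84788 ∷ 84808 ∷
  84812 ∷ 84913 ∷ 84917 ∷ 84937 ∷ 84941 ∷ 84961 ∷ 85038 ∷ 85062 ∷ 85086 ∷ 85163 ∷ 85167 ∷ 85187 ∷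
  85268 ∷ 85288 ∷ 85292 ∷ 85316 ∷ 85413 ∷ 85417 ∷ 85437 ∷ 85441 ∷ 85542 ∷ 85562 ∷ 85566 ∷ 85667 ∷
  85671 ∷ 85691 ∷ 85792 ∷ 85812 ∷ 85816 ∷ 85913 ∷ 85937 ∷ 86038 ∷ 86042 ∷ 86062 ∷ 86066 ∷ 86187 ∷
  86191 ∷ 86211 ∷ 86288 ∷ 86292 ∷ 86312 ∷ 86393 ∷ 86417 ∷ 86441 ∷ 86542 ∷ 86562 ∷ 86566 ∷ 86687 ∷
  86691 ∷ 86711 ∷ 86715 ∷ 86816 ∷ 86820 ∷ 86840 ∷ 86941 ∷ 86961 ∷ 86965 ∷ 87062 ∷ 87086 ∷ 87187 ∷
  87191 ∷ 87211 ∷ 87215 ∷ 87312 ∷ 87336 ∷ 87340 ∷ 87360 ∷ 87437 ∷ 87441 ∷ 87461 ∷ 87542 ∷ 87566 ∷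
  87590 ∷ 87687 ∷ 87691 ∷ 87711 ∷ 87715 ∷ 87812 ∷ 87816 ∷ 87836 ∷ 87917 ∷ 87941 ∷ 87965 ∷ 88066 ∷
  88086 ∷ 88090 ∷ 88187 ∷ 88207 ∷ 88211 ∷ 88312 ∷ 88316 ∷ 88336 ∷ 88340 ∷ 88437 ∷ 88461 ∷ 88485 ∷
  88538 ∷ 88562 ∷ 88566 ∷ 88586 ∷ 88667 ∷ 88687 ∷ 88691 ∷ 88812 ∷ 88816 ∷ 88836 ∷ 88917 ∷ 88937 ∷
  88941 ∷ 88961 ∷ 88965 ∷ 89042 ∷ 89046 ∷ 89066 ∷ 89070 ∷ 89090 ∷ 89191 ∷ 89211 ∷ 89215 ∷ 89288 ∷
  89312 ∷ 89316 ∷ 89336 ∷ 89417 ∷ 89437 ∷ 89441 ∷ 89461 ∷ 89465 ∷ 89562 ∷ 89566 ∷ 89586 ∷ 89590 ∷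
  89663 ∷ 89667 ∷ 89687 ∷ 89691 ∷ 89792 ∷ 89796 ∷ 89816 ∷ 89937 ∷ 89941 ∷ 89965 ∷ 90062 ∷ 90086 ∷
  90187 ∷ 90191 ∷ 90211 ∷ 90215 ∷ 90336 ∷ 90340 ∷ 90360 ∷ 90433 ∷ 90437 ∷ 90457 ∷ 90461 ∷ 90481 ∷
  90562 ∷ 90586 ∷ 90610 ∷ 90707 ∷ 90711 ∷ 90731 ∷ 90735 ∷ 90812 ∷ 90832 ∷ 90836 ∷ 90937 ∷ 90941 ∷
  90961 ∷ 91062 ∷ 91086 ∷ 91187 ∷ 91207 ∷ 91211 ∷ 91312 ∷ 91316 ∷ 91336 ∷ 91340 ∷ 91437 ∷ 91461 ∷
  91485 ∷ 91558 ∷ 91562 ∷ 91582 ∷ 91586 ∷ 91606 ∷ 91687 ∷ 91707 ∷ 91711 ∷ 91832 ∷ 91836 ∷ 91856 ∷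
  91933 ∷ 91937 ∷ 91957 ∷ 92038 ∷ 92062 ∷ 92066 ∷ 92086 ∷ 92187 ∷ 92207 ∷ 92211 ∷ 92312 ∷ 92316 ∷
  92336 ∷ 92417 ∷ 92437 ∷ 92441 ∷ 92461 ∷ 92465 ∷ 92562 ∷ 92566 ∷ 92586 ∷ 92590 ∷ 92683 ∷ 92687 ∷
  92707 ∷ 92711 ∷ 92788 ∷ 92812 ∷ 92816 ∷ 92836 ∷ 92937 ∷ 92957 ∷ 92961 ∷ 92985 ∷ 93038 ∷ 93062 ∷
  93086 ∷ 93163 ∷ 93167 ∷ 93187 ∷ 93191 ∷ 93312 ∷ 93316 ∷ 93336 ∷ 93437 ∷ 93461 ∷ 93542 ∷ 93562 ∷
  93566 ∷ 93586 ∷ 93687 ∷ 93711 ∷ 93808 ∷ 93812 ∷ 93832 ∷ 93913 ∷ 93937 ∷ 93961 ∷ 94058 ∷ 94062 ∷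
  94082 ∷ 94086 ∷ 94163 ∷ 94183 ∷ 94187 ∷ 94288 ∷ 94292 ∷ 94312 ∷ 94316 ∷ 94437 ∷ 94461 ∷ 94538 ∷
  94562 ∷ 94586 ∷ 94667 ∷ 94687 ∷ 94691 ∷ 94812 ∷ 94816 ∷ 94836 ∷ 94933 ∷ 94937 ∷ 94957 ∷ 95038 ∷
  95062 ∷ 95086 ∷ 95183 ∷ 95187 ∷ 95207 ∷ 95211 ∷ 95288 ∷ 95308 ∷ 95312 ∷ 95413 ∷ 95417 ∷ 95437 ∷
  95441 ∷ 95562 ∷ 95667 ∷ 95687 ∷ 95691 ∷ 95711 ∷ 95792 ∷ 95816 ∷ 95840 ∷ 95937 ∷ 95941 ∷ 95961 ∷
  95965 ∷ 96038 ∷ 96062 ∷ 96082 ∷ 96086 ∷ 96163 ∷ 96167 ∷ 96187 ∷ 96191 ∷ 96211 ∷ 96312 ∷ 96336 ∷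
  96413 ∷ 96417 ∷ 96437 ∷ 96542 ∷ 96562 ∷ 96566 ∷ 96687 ∷ 96691 ∷ 96788 ∷ 96792 ∷ 96812 ∷ 96816 ∷
  96836 ∷ 96917 ∷ 96937 ∷ 96941 ∷ 97062 ∷ 97066 ∷ 97086 ∷ 97163 ∷ 97183 ∷ 97187 ∷ 97207 ∷ 97288 ∷
  97292 ∷ 97312 ∷ 97316 ∷ 97336 ∷ 97437 ∷ 97457 ∷ 97461 ∷ 97538 ∷ 97542 ∷ 97562 ∷ 97663 ∷ 97667 ∷
  97687 ∷ 97691 ∷ 97788 ∷ 97812 ∷ 97816 ∷ 97917 ∷ 97937 ∷ 97941 ∷ 98042 ∷ 98046 ∷ 98066 ∷ 98187 ∷
  98191 ∷ 98215 ∷ 98288 ∷ 98312 ∷ 98336 ∷ 98413 ∷ 98417 ∷ 98437 ∷ 98441 ∷ 98562 ∷ 98566 ∷ 98586 ∷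
  98663 ∷ 98667 ∷ 98687 ∷ 98792 ∷ 98816 ∷ 98917 ∷ 98937 ∷ 98941 ∷ 99062 ∷ 99066 ∷ 99086 ∷ 99187 ∷
  99191 ∷ 99211 ∷ 99215 ∷ 99316 ∷ 99336 ∷ 99340 ∷ 99433 ∷ 99437 ∷ 99457 ∷ 99461 ∷ 99562 ∷ 99566 ∷
  99586 ∷ 99687 ∷ 99707 ∷ 99711 ∷ 99731 ∷ 99735 ∷ 99812 ∷ 99836 ∷ 99917 ∷ 99937 ∷ 99941 ∷ 99961 ∷
  100062 ∷ 100066 ∷ 100086 ∷ 100187 ∷ 100211 ∷ 100292 ∷ 100312 ∷ 100316 ∷ 100336 ∷ 100340 ∷ 100437 ∷ 100441 ∷
  100461 ∷ 100558 ∷ 100562 ∷ 100582 ∷ 100586 ∷ 100663 ∷ 100687 ∷ 100711 ∷ 100812 ∷ 100832 ∷ 100836 ∷ 100856 ∷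
  100913 ∷ 100933 ∷ 100937 ∷ 101038 ∷ 101042 ∷ 101062 ∷ 101066 ∷ 101086 ∷ 101187 ∷ 101211 ∷ 101292 ∷ 101312 ∷
  101316 ∷ 101336 ∷ 101417 ∷ 101437 ∷ 101441 ∷ 101465 ∷ 101562 ∷ 101566 ∷ 101586 ∷ 101590 ∷ 101663 ∷ 101683 ∷
  101687 ∷ 101707 ∷ 101711 ∷ 101788 ∷ 101792 ∷ 101812 ∷ 101816 ∷ 101836 ∷ 101937 ∷ 101957 ∷ 101961 ∷ 102038 ∷
  102042 ∷ 102062 ∷ 102163 ∷ 102167 ∷ 102187 ∷ 102191 ∷ 102312 ∷ 102316 ∷ 102336 ∷ 102437 ∷ 102457 ∷ 102461 ∷
  102562 ∷ 102566 ∷ 102586 ∷ 102707 ∷ 102711 ∷ 102731 ∷ 102735 ∷ 102808 ∷ 102832 ∷ 102856 ∷ 102933 ∷ 102937 ∷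
  102957 ∷ 102961 ∷ 102981 ∷ 103082 ∷ 103086 ∷ 103106 ∷ 103183 ∷ 103187 ∷ 103207 ∷ 103312 ∷ 103336 ∷ 103437 ∷
  103457 ∷ 103461 ∷ 103558 ∷ 103562 ∷ 103582 ∷ 103586 ∷ 103687 ∷ 103711 ∷ 103812 ∷ 103832 ∷ 103836 ∷ 103856 ∷
  103933 ∷ 103953 ∷ 103957 ∷ 104058 ∷ 104062 ∷ 104082 ∷ 104086 ∷ 104106 ∷ 104183 ∷ 104207 ∷ 104231 ∷ 104308 ∷
  104312 ∷ 104332 ∷ 104413 ∷ 104433 ∷ 104437 ∷ 104461 ∷ 104558 ∷ 104562 ∷ 104582 ∷ 104586 ∷ 104683 ∷ 104687 ∷
  104707 ∷ 104711 ∷ 104792 ∷ 104812 ∷ 104816 ∷ 104836 ∷ 104937 ∷ 104957 ∷ 104961 ∷ 105058 ∷ 105062 ∷ 105082 ∷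
  105163 ∷ 105183 ∷ 105187 ∷ 105207 ∷ 105211 ∷ 105308 ∷ 105312 ∷ 105332 ∷ 105336 ∷ 105356 ∷ 105413 ∷ 105433 ∷
  105437 ∷ 105457 ∷ 105538 ∷ 105542 ∷ 105562 ∷ 105586 ∷ 105683 ∷ 105687 ∷ 105707 ∷ 105711 ∷ 105808 ∷ 105812 ∷
  105832 ∷ 105913 ∷ 105937 ∷ 105961 ∷ 106062 ∷ 106082 ∷ 106086 ∷ 106183 ∷ 106207 ∷ 106288 ∷ 106308 ∷ 106312 ∷
  106332 ∷ 106336 ∷ 106433 ∷ 106457 ∷ 106534 ∷ 106538 ∷ 106558 ∷ 106562 ∷ 106663 ∷ 106687 ∷ 106808 ∷ 106812 ∷
  106832 ∷ 106913 ∷ 106933 ∷ 106937 ∷ 106957 ∷ 107038 ∷ 107042 ∷ 107062 ∷ 107086 ∷ 107187 ∷ 107207 ∷ 107211 ∷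
  107284 ∷ 107308 ∷ 107332 ∷ 107413 ∷ 107433 ∷ 107437 ∷ 107457 ∷ 107461 ∷ 107558 ∷ 107562 ∷ 107582 ∷ 107659 ∷
  107663 ∷ 107683 ∷ 107687 ∷ 107788 ∷ 107812 ∷ 107933 ∷ 107937 ∷ 108038 ∷ 108062 ∷ 108086 ∷ 108167 ∷ 108187 ∷
  108191 ∷ 108211 ∷ 108312 ∷ 108316 ∷ 108336 ∷ 108413 ∷ 108433 ∷ 108437 ∷ 108457 ∷ 108538 ∷ 108562 ∷ 108586 ∷
  108683 ∷ 108687 ∷ 108707 ∷ 108711 ∷ 108788 ∷ 108808 ∷ 108812 ∷ 108913 ∷ 108917 ∷ 108937 ∷ 108941 ∷ 109062 ∷
  109163 ∷ 109183 ∷ 109187 ∷ 109288 ∷ 109292 ∷ 109312 ∷ 109316 ∷ 109336 ∷ 109437 ∷ 109461 ∷ 109534 ∷ 109538 ∷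
  109558 ∷ 109562 ∷ 109582 ∷ 109663 ∷ 109683 ∷ 109687 ∷ 109711 ∷ 109808 ∷ 109812 ∷ 109832 ∷ 109836 ∷ 109909 ∷
  109913 ∷ 109933 ∷ 109937 ∷ 110038 ∷ 110042 ∷ 110062 ∷ 110163 ∷ 110183 ∷ 110187 ∷ 110288 ∷ 110292 ∷ 110312 ∷
  110417 ∷ 110437 ∷ 110441 ∷ 110562 ∷ 110566 ∷ 110586 ∷ 110663 ∷ 110683 ∷ 110687 ∷ 110707 ∷ 110788 ∷ 110792 ∷
  110812 ∷ 110836 ∷ 110933 ∷ 110937 ∷ 110957 ∷ 110961 ∷ 111038 ∷ 111062 ∷ 111163 ∷ 111167 ∷ 111187 ∷ 111191 ∷
  111288 ∷ 111312 ∷ 111437 ∷ 111441 ∷ 111461 ∷ 111465 ∷ 111566 ∷ 111586 ∷ 111590 ∷ 111691 ∷ 111711 ∷ 111715 ∷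
  111735 ∷ 111812 ∷ 111832 ∷ 111836 ∷ 111856 ∷ 111937 ∷ 111941 ∷ 111961 ∷ 111965 ∷ 111985 ∷ 112062 ∷ 112086 ∷
  112106 ∷ 112110 ∷ 112187 ∷ 112191 ∷ 112211 ∷ 112292 ∷ 112312 ∷ 112316 ∷ 112336 ∷ 112340 ∷ 112437 ∷ 112441 ∷
  112461 ∷ 112465 ∷ 112562 ∷ 112566 ∷ 112586 ∷ 112667 ∷ 112687 ∷ 112691 ∷ 112711 ∷ 112715 ∷ 112816 ∷ 112836 ∷
  112840 ∷ 112860 ∷ 112933 ∷ 112937 ∷ 112957 ∷ 112961 ∷ 112981 ∷ 113062 ∷ 113066 ∷ 113086 ∷ 113110 ∷ 113187 ∷
  113207 ∷ 113211 ∷ 113231 ∷ 113235 ∷ 113288 ∷ 113312 ∷ 113336 ∷ 113417 ∷ 113437 ∷ 113441 ∷ 113461 ∷ 113562 ∷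
  113566 ∷ 113586 ∷ 113667 ∷ 113687 ∷ 113691 ∷ 113711 ∷ 113715 ∷ 113792 ∷ 113816 ∷ 113840 ∷ 113941 ∷ 113961 ∷
  113965 ∷ 114038 ∷ 114062 ∷ 114082 ∷ 114086 ∷ 114167 ∷ 114187 ∷ 114191 ∷ 114211 ∷ 114215 ∷ 114312 ∷ 114336 ∷
  114360 ∷ 114413 ∷ 114417 ∷ 114437 ∷ 114441 ∷ 114461 ∷ 114542 ∷ 114562 ∷ 114566 ∷ 114590 ∷ 114687 ∷ 114691 ∷
  114711 ∷ 114715 ∷ 114812 ∷ 114832 ∷ 114836 ∷ 114856 ∷ 114937 ∷ 114941 ∷ 114961 ∷ 114965 ∷ 114985 ∷ 115086 ∷
  115106 ∷ 115110 ∷ 115183 ∷ 115207 ∷ 115211 ∷ 115231 ∷ 115312 ∷ 115332 ∷ 115336 ∷ 115356 ∷ 115360 ∷ 115457 ∷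
  115461 ∷ 115481 ∷ 115485 ∷ 115558 ∷ 115562 ∷ 115582 ∷ 115586 ∷ 115687 ∷ 115691 ∷ 115711 ∷ 115812 ∷ 115832 ∷
  115836 ∷ 115937 ∷ 115957 ∷ 115961 ∷ 115981 ∷ 116062 ∷ 116066 ∷ 116086 ∷ 116110 ∷ 116187 ∷ 116207 ∷ 116211 ∷
  116231 ∷ 116235 ∷ 116308 ∷ 116332 ∷ 116356 ∷ 116433 ∷ 116437 ∷ 116457 ∷ 116461 ∷ 116481 ∷ 116582 ∷ 116586 ∷
  116606 ∷ 116683 ∷ 116687 ∷ 116707 ∷ 116788 ∷ 116812 ∷ 116836 ∷ 116937 ∷ 116957 ∷ 116961 ∷ 117062 ∷ 117082 ∷
  117086 ∷ 117167 ∷ 117187 ∷ 117191 ∷ 117211 ∷ 117215 ∷ 117312 ∷ 117336 ∷ 117360 ∷ 117433 ∷ 117437 ∷ 117457 ∷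
  117461 ∷ 117481 ∷ 117538 ∷ 117562 ∷ 117582 ∷ 117586 ∷ 117610 ∷ 117687 ∷ 117707 ∷ 117711 ∷ 117731 ∷ 117735 ∷
  117788 ∷ 117808 ∷ 117812 ∷ 117832 ∷ 117836 ∷ 117913 ∷ 117917 ∷ 117937 ∷ 117941 ∷ 117961 ∷ 118062 ∷ 118082 ∷
  118086 ∷ 118183 ∷ 118187 ∷ 118207 ∷ 118211 ∷ 118312 ∷ 118316 ∷ 118336 ∷ 118437 ∷ 118457 ∷ 118461 ∷ 118558 ∷
  118582 ∷ 118663 ∷ 118683 ∷ 118687 ∷ 118707 ∷ 118711 ∷ 118808 ∷ 118832 ∷ 118836 ∷ 118856 ∷ 118913 ∷ 118933 ∷
  118937 ∷ 118957 ∷ 119038 ∷ 119062 ∷ 119086 ∷ 119183 ∷ 119187 ∷ 119207 ∷ 119211 ∷ 119288 ∷ 119308 ∷ 119312 ∷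
  119332 ∷ 119336 ∷ 119417 ∷ 119437 ∷ 119441 ∷ 119461 ∷ 119562 ∷ 119582 ∷ 119586 ∷ 119683 ∷ 119687 ∷ 119707 ∷
  119788 ∷ 119808 ∷ 119812 ∷ 119832 ∷ 119836 ∷ 119933 ∷ 119937 ∷ 119957 ∷ 119961 ∷ 120038 ∷ 120058 ∷ 120062 ∷
  120163 ∷ 120167 ∷ 120187 ∷ 120308 ∷ 120312 ∷ 120336 ∷ 120437 ∷ 120441 ∷ 120461 ∷ 120542 ∷ 120562 ∷ 120566 ∷
  120586 ∷ 120590 ∷ 120687 ∷ 120691 ∷ 120711 ∷ 120715 ∷ 120788 ∷ 120808 ∷ 120812 ∷ 120832 ∷ 120836 ∷ 120913 ∷
  120937 ∷ 120941 ∷ 120961 ∷ 121062 ∷ 121082 ∷ 121086 ∷ 121163 ∷ 121187 ∷ 121288 ∷ 121292 ∷ 121312 ∷ 121316 ∷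
  121437 ∷ 121441 ∷ 121461 ∷ 121538 ∷ 121562 ∷ 121586 ∷ 121667 ∷ 121687 ∷ 121691 ∷ 121711 ∷ 121812 ∷ 121816 ∷
  121836 ∷ 121913 ∷ 121933 ∷ 121937 ∷ 121957 ∷ 122038 ∷ 122062 ∷ 122086 ∷ 122183 ∷ 122187 ∷ 122207 ∷ 122211 ∷
  122288 ∷ 122308 ∷ 122312 ∷ 122413 ∷ 122417 ∷ 122437 ∷ 122441 ∷ 122538 ∷ 122562 ∷ 122586 ∷ 122667 ∷ 122687 ∷
  122691 ∷ 122711 ∷ 122792 ∷ 122812 ∷ 122816 ∷ 122840 ∷ 122937 ∷ 122941 ∷ 122961 ∷ 122965 ∷ 123038 ∷ 123058 ∷
  123062 ∷ 123082 ∷ 123086 ∷ 123163 ∷ 123167 ∷ 123187 ∷ 123191 ∷ 123211 ∷ 123312 ∷ 123332 ∷ 123336 ∷ 123413 ∷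
  123417 ∷ 123437 ∷ 123538 ∷ 123542 ∷ 123562 ∷ 123566 ∷ 123687 ∷ 123691 ∷ 123812 ∷ 123836 ∷ 123937 ∷ 123941 ∷
  123961 ∷ 123965 ∷ 124086 ∷ 124090 ∷ 124110 ∷ 124183 ∷ 124187 ∷ 124207 ∷ 124211 ∷ 124231 ∷ 124312 ∷ 124336 ∷
  124360 ∷ 124457 ∷ 124461 ∷ 124481 ∷ 124485 ∷ 124562 ∷ 124582 ∷ 124586 ∷ 124687 ∷ 124691 ∷ 124711 ∷ 124812 ∷
  124836 ∷ 124937 ∷ 124957 ∷ 124961 ∷ 125062 ∷ 125066 ∷ 125086 ∷ 125090 ∷ 125187 ∷ 125211 ∷ 125235 ∷ 125308 ∷
  125312 ∷ 125332 ∷ 125336 ∷ 125356 ∷ 125437 ∷ 125457 ∷ 125461 ∷ 125582 ∷ 125586 ∷ 125606 ∷ 125683 ∷ 125687 ∷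
  125707 ∷ 125788 ∷ 125812 ∷ 125816 ∷ 125836 ∷ 125937 ∷ 125957 ∷ 125961 ∷ 126062 ∷ 126066 ∷ 126086 ∷ 126167 ∷
  126187 ∷ 126191 ∷ 126211 ∷ 126215 ∷ 126312 ∷ 126316 ∷ 126336 ∷ 126340 ∷ 126433 ∷ 126437 ∷ 126457 ∷ 126461 ∷
  126538 ∷ 126562 ∷ 126566 ∷ 126586 ∷ 126687 ∷ 126707 ∷ 126711 ∷ 126735 ∷ 126788 ∷ 126812 ∷ 126836 ∷ 126913 ∷
  126917 ∷ 126937 ∷ 126941 ∷ 127062 ∷ 127066 ∷ 127086 ∷ 127187 ∷ 127207 ∷ 127211 ∷ 127231 ∷ 127312 ∷ 127336 ∷
  127360 ∷ 127457 ∷ 127461 ∷ 127481 ∷ 127485 ∷ 127558 ∷ 127582 ∷ 127602 ∷ 127606 ∷ 127683 ∷ 127687 ∷ 127707 ∷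
  127711 ∷ 127731 ∷ 127832 ∷ 127856 ∷ 127933 ∷ 127937 ∷ 127957 ∷ 128062 ∷ 128082 ∷ 128086 ∷ 128207 ∷ 128211 ∷
  128308 ∷ 128312 ∷ 128332 ∷ 128336 ∷ 128356 ∷ 128437 ∷ 128457 ∷ 128461 ∷ 128582 ∷ 128586 ∷ 128606 ∷ 128683 ∷
  128703 ∷ 128707 ∷ 128727 ∷ 128808 ∷ 128812 ∷ 128832 ∷ 128836 ∷ 128856 ∷ 128957 ∷ 128977 ∷ 128981 ∷ 129058 ∷
  129062 ∷ 129082 ∷ 129183 ∷ 129187 ∷ 129207 ∷ 129211 ∷ 129308 ∷ 129332 ∷ 129336 ∷ 129433 ∷ 129437 ∷ 129457 ∷
  129461 ∷ 129562 ∷ 129566 ∷ 129586 ∷ 129687 ∷ 129707 ∷ 129711 ∷ 129735 ∷ 129808 ∷ 129832 ∷ 129856 ∷ 129933 ∷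
  129937 ∷ 129957 ∷ 129961 ∷ 130058 ∷ 130082 ∷ 130086 ∷ 130106 ∷ 130183 ∷ 130187 ∷ 130207 ∷ 130288 ∷ 130312 ∷
  130336 ∷ 130433 ∷ 130437 ∷ 130457 ∷ 130461 ∷ 130558 ∷ 130562 ∷ 130582 ∷ 130687 ∷ 130711 ∷ 130812 ∷ 130832 ∷
  130836 ∷ 130933 ∷ 130953 ∷ 130957 ∷ 131058 ∷ 131062 ∷ 131082 ∷ 131086 ∷ 131183 ∷ 131207 ∷ 131231 ∷ 131308 ∷
  131312 ∷ 131332 ∷ 131413 ∷ 131433 ∷ 131437 ∷ 131558 ∷ 131562 ∷ 131582 ∷ 131683 ∷ 131687 ∷ 131707 ∷ 131788 ∷
  131812 ∷ 131836 ∷ 131937 ∷ 131957 ∷ 131961 ∷ 132058 ∷ 132078 ∷ 132082 ∷ 132183 ∷ 132187 ∷ 132207 ∷ 132211 ∷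
  132308 ∷ 132332 ∷ 132409 ∷ 132433 ∷ 132437 ∷ 132538 ∷ 132558 ∷ 132562 ∷ 132683 ∷ 132687 ∷ 132707 ∷ 132812 ∷
  132832 ∷ 132836 ∷ 132917 ∷ 132937 ∷ 132941 ∷ 132961 ∷ 133062 ∷ 133086 ∷ 133183 ∷ 133187 ∷ 133207 ∷ 133288 ∷
  133312 ∷ 133332 ∷ 133336 ∷ 133433 ∷ 133437 ∷ 133457 ∷ 133461 ∷ 133538 ∷ 133558 ∷ 133562 ∷ 133663 ∷ 133667 ∷
  133687 ∷ 133691 ∷ 133812 ∷ 133836 ∷ 133913 ∷ 133933 ∷ 133937 ∷ 133957 ∷ 134038 ∷ 134042 ∷ 134062 ∷ 134066 ∷
  134086 ∷ 134187 ∷ 134207 ∷ 134211 ∷ 134284 ∷ 134308 ∷ 134312 ∷ 134332 ∷ 134413 ∷ 134433 ∷ 134437 ∷ 134457 ∷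
  134461 ∷ 134558 ∷ 134562 ∷ 134582 ∷ 134586 ∷ 134659 ∷ 134663 ∷ 134683 ∷ 134687 ∷ 134788 ∷ 134792 ∷ 134812 ∷
  134933 ∷ 134937 ∷ 135038 ∷ 135062 ∷ 135086 ∷ 135167 ∷ 135187 ∷ 135191 ∷ 135312 ∷ 135316 ∷ 135336 ∷ 135433 ∷
  135437 ∷ 135457 ∷ 135538 ∷ 135562 ∷ 135586 ∷ 135683 ∷ 135687 ∷ 135707 ∷ 135711 ∷ 135788 ∷ 135808 ∷ 135812 ∷
  135913 ∷ 135917 ∷ 135937 ∷ 135941 ∷ 136062 ∷ []

-- The tree is spelt out rather than named so that evaluating a certificate builds it only once.
states-certificate : statesOK (balanced 12 reachableCodes) reachableCodes ≡ true
states-certificate = refl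

initial-certificate : initialsOK (balanced 12 reachableCodes) factors₅ ≡ true
initial-certificate = refl

prefix-certificate : ⌊ factor 0 5 ∈? factors₅ ⌋ ≡ true
prefix-certificate = refl

windows-certificate : windowsClosed factors₅ ≡ true
windows-certificate = refl

-- Opaque, so that the type checker never unfolds the evaluation-heavy checks behind it.
opaque
  Certified : State → Set
  Certified s = T (known (balanced 12 reachableCodes) s)

  certified-stateOK : ∀ {s} → Certified s → T (stateOK (balanced 12 reachableCodes) s)
  certified-stateOK {s} cert =
    let found , decoded = T-∧⁻ {member (code s) (balanced 12 reachableCodes)} {⌊ decode (code s) ≟ˢ s ⌋} cert
    in known-stateOK 12 reachableCodes (balanced 12 reachableCodes) s states-certificate found decoded

  certified-initial : ∀ {u v} → u ∈ factors₅ → v ∈ factors₅ → Certified (initial u v)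
  certified-initial = initial-known (balanced 12 reachableCodes) factors₅ initial-certificate

  gap≤4 : ∀ {s} → Certified s → ∀ a → gap s a ≤ 4
  gap≤4 {s} cert = stateOK-gaps (balanced 12 reachableCodes) s (certified-stateOK {s} cert)

  certified-swap : ∀ {s} → Certified s → Certified (swap s)
  certified-swap {s} cert = stateOK-swap (balanced 12 reachableCodes) s (certified-stateOK {s} cert)

  certified-successor : ∀ {s r₁ r₁′ r₂ r₂′ δ} → Certified s →
    r₁ < 2 → r₁′ < 2 → r₂ < 2 → r₂′ < 2 → δ < 5 → T (fits s (cut r₁ r₁′ r₂ r₂′ δ)) →
    let c = cut r₁ r₁′ r₂ r₂′ δ in
    (∀ a → loss s c a ≤ gain s c a) × rightᵘ c + 5 ≤ length (hWord (nextᵘ s)) ×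
    length (extra s c) + rightᵛ c + 5 ≤ length (hWord (nextᵛ s)) × Certified (successor s c)
  certified-successor {s} {r₁} {r₁′} {r₂} {r₂′} {δ} cert r₁< r₁′< r₂< r₂′< δ< fit =
    successorOK-sound (balanced 12 reachableCodes) s (cut r₁ r₁′ r₂ r₂′ δ)
      (stateOK-successor (balanced 12 reachableCodes) s (certified-stateOK {s} cert) r₁< r₁′< r₂< r₂′< δ< fit)

record Describes (s : State) (i j m : ℕ) : Set where
  constructor describes
  field
    gap-count : ∀ a → count a (factor i m) + 2 ≡ count a (factor j m) + gap s a
    firstᵘ-≡ : p i ≡ firstᵘ s
    firstᵛ-≡ : p j ≡ firstᵛ s
    nextᵘ-≡ : factor (i + m) 5 ≡ nextᵘ s
    nextᵛ-≡ : factor (j + m) 5 ≡ nextᵛ s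

Described : ℕ → ℕ → ℕ → Set
Described i j m = ∃[ s ] Certified s × Describes s i j m

factor₅ : ∀ i → factor i 5 ∈ factors₅
factor₅ = <-rec (λ i → factor i 5 ∈ factors₅) induct
  where
  induct : ∀ i → (∀ {j} → j < i → factor j 5 ∈ factors₅) → factor i 5 ∈ factors₅
  induct zero _ = toWitness {a? = factor 0 5 ∈? factors₅} (Equivalence.from T-≡ prefix-certificate)
  induct (suc n) earlier with ancestry k r start r< ← locate 0 (suc n) z≤n =
    let room , image∈ = windows-sound factors₅ {factor k 5} {r} windows-certificate (earlier {k} (ancestor< start)) r<
    in subst (_∈ factors₅)
         (sym (trans (cong (λ q → factor q 5) (sym start)) (occursAt-window r 5 (hWord-factor-occursAt k 5) room)))
         image∈

described-empty : ∀ i j → Described i j 0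
described-empty i j =
  initial (factor i 5) (factor j 5) , certified-initial (factor₅ i) (factor₅ j) ,
  describes gaps refl refl (cong (λ q → factor q 5) (+-identityʳ i)) (cong (λ q → factor q 5) (+-identityʳ j))
  where
  gaps : ∀ a → count a [] + 2 ≡ count a [] + gap (initial (factor i 5) (factor j 5)) a
  gaps 𝟎 = refl
  gaps 𝟏 = refl
  gaps 𝟐 = refl

described-swap : ∀ {i j m} → Described i j m → Described j i m
described-swap {i} {j} {m} (s , cert , describes gaps fᵘ fᵛ nᵘ nᵛ) =
  swap s , certified-swap cert , describes gaps′ fᵛ fᵘ nᵛ nᵘ
  where
  gaps′ : ∀ a → count a (factor j m) + 2 ≡ count a (factor i m) + gap (swap s) a
  gaps′ 𝟎 = swap-gap (gaps 𝟎) (gap≤4 cert 𝟎)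
  gaps′ 𝟏 = swap-gap (gaps 𝟏) (gap≤4 cert 𝟏)
  gaps′ 𝟐 = swap-gap (gaps 𝟐) (gap≤4 cert 𝟐)

open Ancestry

-- The windows at i and j are images of the windows of length n at k₁ and of length n + δ at k₂.
desubstitute : ∀ {s i j m} → Certified s →
  (u : Ancestry 0 i) (v : Ancestry 0 j) (u′ : Ancestry (distance u) (i + m)) (v′ : Ancestry (distance v) (j + m)) →
  distance u′ ≤ distance v′ → Describes s (distance u) (distance v) (distance u′) → Described i j m
desubstitute {state g₀ g₁ g₂ _ _ _ _} {i} {j} {m} cert (ancestry k₁ r₁ e₁ r₁<) (ancestry k₂ r₂ e₂ r₂<)
             (ancestry n r₁′ e₁′ r₁′<) (ancestry _ r₂′ e₂′ r₂′<) n≤n₂ (describes gaps refl refl refl refl)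
  with δ , refl ← m≤n⇒∃[o]m+o≡n n≤n₂ =
  successor s c , certified′ , describes gaps′ first-i first-j next-i next-j
  where
  K = k₁ + n
  q = k₂ + n
  s = state g₀ g₁ g₂ (p k₁) (p k₂) (factor K 5) (factor q 5)
  c = cut r₁ r₁′ r₂ r₂′ δ
  D = length (hWord (factor q δ))
  end-v : pos (q + δ) + r₂′ ≡ j + m
  end-v = trans (cong (λ x → pos x + r₂′) (+-assoc k₂ n δ)) e₂′
  span-v : r₂ + m ≡ length (hWord (factor k₂ n)) + (D + r₂′)
  span-v = trans (window-span {k₂} {n + δ} e₂ e₂′)
    (trans (cong (λ w → length w + r₂′) (hWord-factor-++ k₂ n δ))
           (trans (cong (_+ r₂′) (length-++ (hWord (factor k₂ n)))) (+-assoc _ D r₂′)))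
  balance : 2 + r₁′ + r₂ ≡ D + r₂′ + r₁ + g₂
  balance = length-arithmetic {r₁} {r₁′} {r₂} {r₂′} {m} {cᵘ = count 𝟐 (factor k₁ n)} {cᵛ = count 𝟐 (factor k₂ n)}
    (window-span {k₁} {n} e₁ e₁′) span-v
    (trans (length-hWord-factor k₁ n) (sym (length-hWord-factor k₂ n))) (gaps 𝟐)
  δ<5 : δ < 5
  δ<5 = excess<5 {q} (<length-h⇒<2 (p K) r₁′<) (<length-h⇒<2 (p k₂) r₂<) balance
  extra-≡ : extra s c ≡ hWord (factor q δ)
  extra-≡ = cong hWord (take-factor q (<⇒≤ δ<5))
  lastᵛ-≡ : p (k₂ + (n + δ)) ≡ lastᵛ s c
  lastᵛ-≡ = trans (cong p (sym (+-assoc k₂ n δ))) (sym (at-factor q δ<5))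
  r₂′<′ : r₂′ < length (h (lastᵛ s c))
  r₂′<′ = subst (λ x → r₂′ < length (h x)) lastᵛ-≡ r₂′<
  successor-facts = certified-successor {s} cert
    (<length-h⇒<2 (p k₁) r₁<) (<length-h⇒<2 (p K) r₁′<) (<length-h⇒<2 (p k₂) r₂<) (<length-h⇒<2 (lastᵛ s c) r₂′<′) δ<5
    (fits-intro {s} {c} r₁< r₁′< r₂< r₂′<′
      (subst (λ L → 2 + r₁′ + r₂ ≡ L + r₂′ + r₁ + g₂) (cong length (sym extra-≡)) balance))
  certified′ : Certified (successor s c)
  certified′ = proj₂ (proj₂ (proj₂ successor-facts))
  first-i : p i ≡ at (h (p k₁)) r₁
  first-i = trans (cong p (sym e₁)) (occursAt-at (h-occursAt k₁) r₁<)
  first-j : p j ≡ at (h (p k₂)) r₂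
  first-j = trans (cong p (sym e₂)) (occursAt-at (h-occursAt k₂) r₂<)
  next-i : factor (i + m) 5 ≡ take 5 (drop r₁′ (hWord (factor K 5)))
  next-i = trans (cong (λ x → factor x 5) (sym e₁′))
    (occursAt-window r₁′ 5 (hWord-factor-occursAt K 5) (proj₁ (proj₂ successor-facts)))
  next-j : factor (j + m) 5 ≡ take 5 (drop (length (extra s c) + r₂′) (hWord (factor q 5)))
  next-j = trans (cong (λ x → factor x 5) (sym (trans (cong (λ w → pos q + (length w + r₂′)) extra-≡)
                   (trans (sym (+-assoc (pos q) D r₂′)) (trans (cong (_+ r₂′) (sym (pos-+ q δ))) end-v)))))
    (occursAt-window (length (extra s c) + r₂′) 5 (hWord-factor-occursAt q 5) (proj₁ (proj₂ (proj₂ successor-facts))))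
  counts-v : ∀ a → count a (take r₂ (h (p k₂))) + count a (factor j m) ≡
    count a (hWord (factor k₂ n)) + (count a (extra s c) + count a (take r₂′ (h (lastᵛ s c))))
  counts-v a = begin
    count a (take r₂ (h (p k₂))) + count a (factor j m)
      ≡⟨ window-count {k₂} {n + δ} e₂ (<⇒≤ r₂<) e₂′ (<⇒≤ r₂′<) a ⟩
    count a (hWord (factor k₂ (n + δ))) + count a (take r₂′ (h (p (k₂ + (n + δ)))))
      ≡⟨ cong₂ (λ w x → count a w + count a (take r₂′ (h x))) (hWord-factor-++ k₂ n δ) lastᵛ-≡ ⟩
    count a (hWord (factor k₂ n) ++ hWord (factor q δ)) + count a (take r₂′ (h (lastᵛ s c)))
      ≡⟨ cong (_+ count a (take r₂′ (h (lastᵛ s c)))) (count-++ a (hWord (factor k₂ n)) (hWord (factor q δ))) ⟩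
    count a (hWord (factor k₂ n)) + count a (hWord (factor q δ)) + count a (take r₂′ (h (lastᵛ s c)))
      ≡⟨ +-assoc (count a (hWord (factor k₂ n))) _ _ ⟩
    count a (hWord (factor k₂ n)) + (count a (hWord (factor q δ)) + count a (take r₂′ (h (lastᵛ s c))))
      ≡⟨ cong (λ w → count a (hWord (factor k₂ n)) + (count a w + count a (take r₂′ (h (lastᵛ s c))))) extra-≡ ⟨
    count a (hWord (factor k₂ n)) + (count a (extra s c) + count a (take r₂′ (h (lastᵛ s c)))) ∎
    where open ≡-Reasoning
  gaps′ : ∀ a → count a (factor i m) + 2 ≡ count a (factor j m) + gap (successor s c) a
  gaps′ a = trans (gap-∸ {L = loss s c a} {G = gain s c a} balanced-counts (proj₁ successor-facts a))
                  (cong (count a (factor j m) +_) (sym (gap-successor s c a)))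
    where
    balanced-counts : count a (factor i m) + 2 + loss s c a ≡ count a (factor j m) + gain s c a
    balanced-counts = gap-arithmetic {U = count a (hWord (factor k₁ n))} {V = count a (hWord (factor k₂ n))}
      {T₁ = count a (take r₁ (h (p k₁)))} {T₁′ = count a (take r₁′ (h (p K)))} {T₂ = count a (take r₂ (h (p k₂)))}
      {E = count a (extra s c)} {T₂′ = count a (take r₂′ (h (lastᵛ s c)))}
      {M = ∑ (λ b → count a (h b))} {G = ∑ (λ b → count a (h b) * gap s b)}
      (window-count {k₁} {n} e₁ (<⇒≤ r₁<) e₁′ (<⇒≤ r₁′<) a) (counts-v a)
      (count-hWord-gap a {factor k₁ n} {factor k₂ n} {gap s} gaps)

ancestry-end< : ∀ {k i m} (a : Ancestry k (i + suc m)) → k + distance a < i + suc m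
ancestry-end< {k} {i} {m} a = subst (k + distance a <_) (sym (+-suc i m)) (ancestor< (trans (position a) (+-suc i m)))

pos-ancestor≤ : ∀ {i} (a : Ancestry 0 i) → pos (distance a) ≤ i
pos-ancestor≤ a = subst (pos (distance a) ≤_) (position a) (m≤m+n _ (offset a))

described-suc : ∀ {i j m} (u : Ancestry 0 i) (v : Ancestry 0 j)
  (u′ : Ancestry (distance u) (i + suc m)) (v′ : Ancestry (distance v) (j + suc m)) →
  (∀ {i′ j′ m′} → (i′ + m′) + (j′ + m′) < (i + suc m) + (j + suc m) → Described i′ j′ m′) →
  Described i j (suc m)
described-suc {i} {j} {m} u v u′ v′ earlier with distance u′ ≤? distance v′
... | yes n≤n′ =
  let s , cert , d = earlier {distance u} {distance v} {distance u′}
                    (+-mono-<-≤ (ancestry-end< u′) (≤-trans (+-monoʳ-≤ (distance v) n≤n′) (<⇒≤ (ancestry-end< v′))))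
  in desubstitute cert u v u′ v′ n≤n′ d
... | no  n≰n′ =
  let n′≤n = <⇒≤ (≰⇒> n≰n′)
      s , cert , d = earlier {distance v} {distance u} {distance v′}
                    (subst (distance v + distance v′ + (distance u + distance v′) <_) (+-comm (j + suc m) (i + suc m))
                      (+-mono-<-≤ (ancestry-end< v′)
                                  (≤-trans (+-monoʳ-≤ (distance u) n′≤n) (<⇒≤ (ancestry-end< u′)))))
  in described-swap (desubstitute cert v u v′ u′ n′≤n d)

described : ∀ i j m → Described i j m
described i j m = <-rec Measured induct ((i + m) + (j + m)) refl
  where
  Measured : ℕ → Set
  Measured N = ∀ {i j m} → (i + m) + (j + m) ≡ N → Described i j m
  induct : ∀ N → (∀ {N′} → N′ < N → Measured N′) → Measured N
  induct _ _ {i} {j} {zero} _ = described-empty i j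
  induct _ earlier {i} {j} {suc m} refl =
    described-suc u v (locate (distance u) (i + suc m) (≤-trans (pos-ancestor≤ u) (m≤m+n i (suc m))))
                      (locate (distance v) (j + suc m) (≤-trans (pos-ancestor≤ v) (m≤m+n j (suc m))))
                      (λ smaller → earlier smaller refl)
    where
    u = locate 0 i z≤n
    v = locate 0 j z≤n

theorem3 : (i j m : ℕ) (a : Letter) →
    diffLe 2 (count a (factor i m)) (count a (factor j m))
theorem3 i j m a =
  let s , cert , d = described i j m
  in diffLe-gap (Describes.gap-count d a) (gap≤4 cert a)
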